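{- (1) For every subset $T'\subseteq S$ and every $n>4$, $\langle S_n(\{123,321\}\cup T')\rangle=\{\mathrm{id}_n\}$. (2) $\langle S_n(213,231,312,321)\rangle\cong\langle S_n(132,231,312,321)\rangle\cong\langle S_n(132,213,231,312)\rangle\cong\mathbb{Z}_2$. (3) $\langle S_n(123,132,213,231)\rangle\cong\langle S_n(123,132,213,312)\rangle\cong D_4$. (4) $\langle S_n(132,213,312,321)\rangle\cong\langle S_n(132,213,231,321)\rangle\cong\mathbb{Z}_n$. (5) $\langle S_n(123,213,231,312)\rangle\cong\langle S_n(123,132,231,312)\rangle\cong D_n$. (6) $\langle S_n(123,132,213,231,312)\rangle\cong\mathbb{Z}_2$. (7) $\langle S_n(132,213,231,312,321)\rangle=\{\mathrm{id}_n\}$. Items (2)–(7) hold for all sufficiently large $n$.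
   Context: $S_n$ is the symmetric group on $[n]$, permutations in one-line notation, $S=\bigcup_{n\ge0}S_n$, $\mathrm{id}_n=12\cdots n$. A permutation $\pi\in S_n$ contains the pattern $\tau\in S_k$ if some subsequence of $\pi$ of length $k$ is order-isomorphic to $\tau$; otherwise it avoids $\tau$. $S_n(T)$ (also written $S_n(\tau_1,\dots,\tau_j)$ for $T=\{\tau_1,\dots,\tau_j\}$) is the set of permutations in $S_n$ avoiding every pattern in $T$, and $\langle A\rangle$ is the subgroup of $S_n$ generated by $A$. $\mathbb{Z}_m$ is the cyclic group of order $m$ and $D_m$ the dihedral group of order $2m$. -}

module Defs where

open import Data.Nat using (ℕ; zero; suc; _+_; _∸_)
open import Data.Nat.DivMod using (_mod_)
open import Data.Fin using (Fin; toℕ; _<_) renaming (zero to 0F; suc to sF)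
open import Data.Fin.Properties using (_≟_; all?)
open import Data.Fin.Permutation public using (Permutation′; permutation; _⟨$⟩ʳ_; _⟨$⟩ˡ_; _≈_; id; flip; _∘ₚ_)
open import Data.Vec using (Vec; []; _∷_; lookup)
open import Data.Bool using (Bool; true; false; if_then_else_; _xor_)
open import Data.Product using (Σ; ∃; _×_; _,_; proj₁; proj₂)
open import Data.List using (List; []; _∷_)
open import Data.List.Membership.Propositional using (_∈_)
open import Relation.Nullary using (¬_)
open import Relation.Nullary.Decidable using (True; toWitness)
open import Relation.Binary.PropositionalEquality using (_≡_)
open import Relation.Unary using (Pred)
open import Function.Bundles using (_⇔_)
open import Level using (0ℓ)

Perm : ℕ → Set
Perm = Permutation′

-- Group product of S_n with the usual convention (π · σ)(i) = π(σ(i)).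
-- (Note: stdlib's σ ∘ₚ π applies σ first, then π.)
infixl 7 _·_
_·_ : ∀ {n} → Perm n → Perm n → Perm n
π · σ = σ ∘ₚ π

-- A permutation given in one-line notation  v = π(1) π(2) ... π(n)
-- (0-based values), together with its inverse w; the inverse laws are
-- checked by decision procedure.
oneLine : ∀ {n} (v w : Vec (Fin n) n)
  → {_ : True (all? (λ i → lookup v (lookup w i) ≟ i))}
  → {_ : True (all? (λ i → lookup w (lookup v i) ≟ i))}
  → Perm n
oneLine v w {p} {q} =
  permutation (lookup v) (lookup w) (toWitness p) (toWitness q)

Pattern : Set
Pattern = Σ ℕ Perm

Contains : ∀ {n k} → Perm n → Perm k → Set
Contains {n} {k} π τ =
  Σ (Fin k → Fin n) λ f →
    (∀ i j → i < j → f i < f j) ×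
    (∀ i j → ((π ⟨$⟩ʳ f i) < (π ⟨$⟩ʳ f j)) ⇔ ((τ ⟨$⟩ʳ i) < (τ ⟨$⟩ʳ j)))

Avoids : ∀ {n k} → Perm n → Perm k → Set
Avoids π τ = ¬ Contains π τ

Av : (n : ℕ) → Pred Pattern 0ℓ → Pred (Perm n) 0ℓ
Av n T π = ∀ p → T p → Avoids π (proj₂ p)

⟦_⟧ : List Pattern → Pred Pattern 0ℓ
⟦ L ⟧ p = p ∈ L

-- The patterns of length 3 (one-line notation, 1-based in the names)

private
  a b c : Fin 3
  a = 0F
  b = sF 0F
  c = sF (sF 0F)

p123 p132 p213 p231 p312 p321 : Pattern
p123 = 3 , oneLine (a ∷ b ∷ c ∷ []) (a ∷ b ∷ c ∷ [])
p132 = 3 , oneLine (a ∷ c ∷ b ∷ []) (a ∷ c ∷ b ∷ [])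
p213 = 3 , oneLine (b ∷ a ∷ c ∷ []) (b ∷ a ∷ c ∷ [])
p231 = 3 , oneLine (b ∷ c ∷ a ∷ []) (c ∷ a ∷ b ∷ [])
p312 = 3 , oneLine (c ∷ a ∷ b ∷ []) (b ∷ c ∷ a ∷ [])
p321 = 3 , oneLine (c ∷ b ∷ a ∷ []) (c ∷ b ∷ a ∷ [])

data ⟨_⟩ {n : ℕ} (A : Pred (Perm n) 0ℓ) : Pred (Perm n) 0ℓ where
  gen  : ∀ {π} → A π → ⟨ A ⟩ π
  one  : ⟨ A ⟩ id
  mul  : ∀ {π σ} → ⟨ A ⟩ π → ⟨ A ⟩ σ → ⟨ A ⟩ (π · σ)
  inv  : ∀ {π} → ⟨ A ⟩ π → ⟨ A ⟩ (flip π)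
  resp : ∀ {π σ} → π ≈ σ → ⟨ A ⟩ π → ⟨ A ⟩ σ

IsTrivial : ∀ {n} → Pred (Perm n) 0ℓ → Set
IsTrivial {n} H = ∀ π → H π ⇔ (π ≈ id)

_⊕_ : ∀ {m} → Fin m → Fin m → Fin m
_⊕_ {suc m} i j = (toℕ i + toℕ j) mod suc m

⊖_ : ∀ {m} → Fin m → Fin m
⊖_ {suc m} i = (suc m ∸ toℕ i) mod suc m

Zc : ℕ → Set
Zc m = Fin m

Zmul : ∀ {m} → Zc m → Zc m → Zc m
Zmul = _⊕_

-- D_m: (i , b) stands for r^i s^b (r rotation of order m, s reflection,
-- s r = r⁻¹ s); product (i,b)(j,c) = (i + (-1)^b j , b xor c).
Dc : ℕ → Set
Dc m = Fin m × Bool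

Dmul : ∀ {m} → Dc m → Dc m → Dc m
Dmul (i , b) (j , c) = (i ⊕ (if b then ⊖ j else j)) , (b xor c)

IsoTo : ∀ {n} → Pred (Perm n) 0ℓ → (C : Set) → (C → C → C) → Set
IsoTo {n} H C _*_ =
  Σ (C → Perm n) λ φ →
    (∀ x → H (φ x)) ×
    (∀ x y → φ x ≈ φ y → x ≡ y) ×
    (∀ π → H π → ∃ λ x → φ x ≈ π) ×
    (∀ x y → φ (x * y) ≈ (φ x · φ y))

≅Z : ∀ {n} → Pred (Perm n) 0ℓ → ℕ → Set
≅Z H m = IsoTo H (Zc m) Zmul

≅D : ∀ {n} → Pred (Perm n) 0ℓ → ℕ → Set
≅D H m = IsoTo H (Dc m) Dmul

Eventually : (ℕ → Set) → Set
Eventually P = ∃ λ N → ∀ n → N Data.Nat.≤ n → P n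

{-# OPTIONS --safe #-}
module Submission where

-- Each class is cut out by the order types its triples may take, and this local condition
-- pins the class down to one or two explicit permutations: allowing only 123 and 231, say,
-- leaves the identity and the cyclic shift 23⋯n1. The generated group is then recognised
-- through a faithful action: Z₂ acting by an involution, Zₙ by the translations of Zₙ, Dₙ by
-- the affine maps x ↦ k ± x of Zₙ, and D₄ by the symmetries of a square on the four end
-- positions 1, 2, n−1, n, reversing the middle exactly when the two sides are swapped. In
-- each of (2)–(5) one class is the reverse-complement of another, and reverse-complement is
-- conjugation by the reversal, an automorphism of Sₙ. Item (1) is the case n = 5 of the
-- Erdős–Szekeres theorem.

open import Defs
open import Data.Nat using (ℕ; _<_)
open import Data.Product using (_×_)
open import Data.List using (_∷_; [])
open import Relation.Unary using (Pred; _∪_)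
open import Level using (0ℓ)

open import Algebra.Bundles using (AbelianGroup)
open import Data.Bool using (Bool; true; false; if_then_else_; _xor_)
import Data.Bool.Properties as Bool
open import Data.Empty using (⊥; ⊥-elim)
open import Data.Fin using (Fin; suc; toℕ; fromℕ; inject₁; opposite) renaming (_<_ to _<ᶠ_)
open import Data.Fin.Patterns using (0F; 1F; 2F; 3F; 4F)
open import Data.Fin.Permutation using (inverseˡ; inverseʳ; reverse)
import Data.Fin.Properties as Fin
open import Data.List using (List; map)
open import Data.List.Membership.Propositional using (_∈_; lose)
open import Data.List.Membership.Propositional.Properties using (∈-map⁺)
open import Data.List.Relation.Binary.Permutation.Propositional using (_↭_; ↭-refl; ↭-prep; ↭-swap)
open import Data.List.Relation.Binary.Permutation.Propositional.Properties using (All-resp-↭)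
open import Data.List.Relation.Unary.All as All using (All; _∷_; [])
import Data.List.Relation.Unary.All.Properties as All
open import Data.List.Relation.Unary.Any using (Any; here; there)
open import Data.Nat using (zero; suc; _+_; _∸_; _≤_; z≤n; s≤s; s≤s⁻¹; z<s; s<s; _%_)
open import Data.Nat.DivMod using (_mod_; %-distribˡ-+; m%n%n≡m%n; m%n<n; m<n⇒m%n≡m; n%n≡0)
import Data.Nat.Properties as ℕ
open import Data.Product using (Σ; ∃; _,_; proj₁; proj₂)
open import Data.Sum using (_⊎_; inj₁; inj₂; [_,_]′)
import Data.Sum as Sum
open import Function using (_∘_)
open import Function.Bundles using (mk⇔; Equivalence)
open import Relation.Binary.Definitions using (tri<; tri≈; tri>)
open import Relation.Binary.PropositionalEquality
  using (_≡_; _≢_; refl; sym; trans; cong; cong₂; subst; subst₂; module ≡-Reasoning)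
import Relation.Binary.PropositionalEquality as ≡
open import Relation.Nullary using (¬_)
open import Relation.Nullary.Decidable using (from-yes)

-- Permutations and their relative order

increasing⇒≤ : ∀ {m n} (f : Fin m → Fin n) → (∀ {i j} → i <ᶠ j → f i <ᶠ f j) → ∀ i → toℕ i ≤ toℕ (f i)
increasing⇒≤ f f-inc 0F      = z≤n
increasing⇒≤ f f-inc (suc i) =
  ℕ.≤-<-trans (increasing⇒≤ (f ∘ inject₁) (f-inc ∘ inject₁-mono) i) (f-inc (Fin.≤̄⇒inject₁< Fin.≤-refl))
  where
  inject₁-mono : ∀ {i j} → i <ᶠ j → inject₁ i <ᶠ inject₁ j
  inject₁-mono {i} {j} = subst₂ _<_ (sym (Fin.toℕ-inject₁ i)) (sym (Fin.toℕ-inject₁ j))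

opposite-reverses : ∀ {n} {i j : Fin n} → i <ᶠ j → opposite j <ᶠ opposite i
opposite-reverses {i = i} {j} i<j = subst₂ _<_ (sym (Fin.opposite-prop j)) (sym (Fin.opposite-prop i))
  (ℕ.∸-monoʳ-< (s≤s i<j) (Fin.toℕ<n j))

opposite-reflects : ∀ {n} {i j : Fin n} → opposite i <ᶠ opposite j → j <ᶠ i
opposite-reflects {i = i} {j} lt =
  subst₂ _<ᶠ_ (Fin.opposite-involutive j) (Fin.opposite-involutive i) (opposite-reverses lt)

module _ {n : ℕ} where

  ·-cong : {π π′ σ σ′ : Perm n} → π ≈ π′ → σ ≈ σ′ → π · σ ≈ π′ · σ′
  ·-cong {π} {σ′ = σ′} p q i = trans (cong (π ⟨$⟩ʳ_) (q i)) (p (σ′ ⟨$⟩ʳ i))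

  flip-cong : {π π′ : Perm n} → π ≈ π′ → flip π ≈ flip π′
  flip-cong {π} {π′} p i = begin
    π ⟨$⟩ˡ i                       ≡⟨ cong (π ⟨$⟩ˡ_) (sym (inverseʳ π′)) ⟩
    π ⟨$⟩ˡ (π′ ⟨$⟩ʳ (π′ ⟨$⟩ˡ i))  ≡⟨ cong (π ⟨$⟩ˡ_) (sym (p (π′ ⟨$⟩ˡ i))) ⟩
    π ⟨$⟩ˡ (π ⟨$⟩ʳ (π′ ⟨$⟩ˡ i))   ≡⟨ inverseˡ π ⟩
    π′ ⟨$⟩ˡ i                      ∎
    where open ≡-Reasoning

  injective : (π : Perm n) {i j : Fin n} → π ⟨$⟩ʳ i ≡ π ⟨$⟩ʳ j → i ≡ j
  injective π eq = trans (sym (inverseˡ π)) (trans (cong (π ⟨$⟩ˡ_) eq) (inverseˡ π))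

  compare-at : (π : Perm n) {i j : Fin n} → i <ᶠ j → π ⟨$⟩ʳ i <ᶠ π ⟨$⟩ʳ j ⊎ π ⟨$⟩ʳ j <ᶠ π ⟨$⟩ʳ i
  compare-at π {i} {j} i<j with Fin.<-cmp (π ⟨$⟩ʳ i) (π ⟨$⟩ʳ j)
  ... | tri< lt _ _ = inj₁ lt
  ... | tri≈ _ eq _ = ⊥-elim (Fin.<⇒≢ i<j (injective π eq))
  ... | tri> _ _ gt = inj₂ gt

  Increasing Decreasing : Perm n → Set
  Increasing π = ∀ i j → i <ᶠ j → π ⟨$⟩ʳ i <ᶠ π ⟨$⟩ʳ j
  Decreasing π = ∀ i j → i <ᶠ j → π ⟨$⟩ʳ j <ᶠ π ⟨$⟩ʳ i

  -- g is increasing and so is g⁻¹, hence i ≤ g i and g i ≤ g⁻¹ (g i) = i.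
  increasing⇒≈id : (g : Perm n) → Increasing g → g ≈ id
  increasing⇒≈id g g-inc i = Fin.toℕ-injective (ℕ.≤-antisym g[i]≤i (increasing⇒≤ (g ⟨$⟩ʳ_) (g-inc _ _) i))
    where
    g⁻¹-inc : ∀ {i j} → i <ᶠ j → g ⟨$⟩ˡ i <ᶠ g ⟨$⟩ˡ j
    g⁻¹-inc {i} {j} i<j with Fin.<-cmp (g ⟨$⟩ˡ i) (g ⟨$⟩ˡ j)
    ... | tri< lt _ _ = lt
    ... | tri≈ _ eq _ = ⊥-elim (Fin.<⇒≢ i<j (injective (flip g) eq))
    ... | tri> _ _ gt = ⊥-elim (Fin.<-asym i<j (subst₂ _<ᶠ_ (inverseʳ g) (inverseʳ g) (g-inc _ _ gt)))
    g[i]≤i : toℕ (g ⟨$⟩ʳ i) ≤ toℕ i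
    g[i]≤i = subst (λ k → toℕ (g ⟨$⟩ʳ i) ≤ toℕ k) (inverseˡ g)
      (increasing⇒≤ (g ⟨$⟩ˡ_) g⁻¹-inc (g ⟨$⟩ʳ i))

  ≈-fromOrder : (π σ : Perm n) →
                (∀ i j → σ ⟨$⟩ʳ i <ᶠ σ ⟨$⟩ʳ j → π ⟨$⟩ʳ i <ᶠ π ⟨$⟩ʳ j) → π ≈ σ
  ≈-fromOrder π σ σ<⇒π< i = begin
    π ⟨$⟩ʳ i                ≡⟨ cong (π ⟨$⟩ʳ_) (sym (inverseˡ σ)) ⟩
    g ⟨$⟩ʳ (σ ⟨$⟩ʳ i)       ≡⟨ increasing⇒≈id g g-inc (σ ⟨$⟩ʳ i) ⟩
    σ ⟨$⟩ʳ i                ∎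
    where
    open ≡-Reasoning
    g : Perm n
    g = π · flip σ
    g-inc : Increasing g
    g-inc x y x<y = σ<⇒π< (σ ⟨$⟩ˡ x) (σ ⟨$⟩ˡ y) (subst₂ _<ᶠ_ (sym (inverseʳ σ)) (sym (inverseʳ σ)) x<y)

  decreasing⇒≈reverse : (π : Perm n) → Decreasing π → π ≈ reverse
  decreasing⇒≈reverse π π-dec = ≈-fromOrder π reverse (λ i j lt → π-dec j i (opposite-reflects lt))

  reverse-decreasing : Decreasing (reverse {n})
  reverse-decreasing i j = opposite-reverses

-- Generated subgroups

record IsSubgroup {n : ℕ} (H : Pred (Perm n) 0ℓ) : Set where
  field
    ∈-resp : ∀ {π σ} → π ≈ σ → H π → H σ
    id-∈   : H id
    ·-∈    : ∀ {π σ} → H π → H σ → H (π · σ)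
    flip-∈ : ∀ {π} → H π → H (flip π)

module _ {n : ℕ} {A : Pred (Perm n) 0ℓ} where

  ⟨⟩-least : ∀ {H} → IsSubgroup H → (∀ {π} → A π → H π) → ∀ {π} → ⟨ A ⟩ π → H π
  ⟨⟩-least H-sub A⊆H (gen a)    = A⊆H a
  ⟨⟩-least H-sub A⊆H one        = IsSubgroup.id-∈ H-sub
  ⟨⟩-least H-sub A⊆H (mul p q)  = IsSubgroup.·-∈ H-sub (⟨⟩-least H-sub A⊆H p) (⟨⟩-least H-sub A⊆H q)
  ⟨⟩-least H-sub A⊆H (inv p)    = IsSubgroup.flip-∈ H-sub (⟨⟩-least H-sub A⊆H p)
  ⟨⟩-least H-sub A⊆H (resp e p) = IsSubgroup.∈-resp H-sub e (⟨⟩-least H-sub A⊆H p)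

  ⟨⟩-trivial : (∀ {π} → A π → π ≈ id) → IsTrivial ⟨ A ⟩
  ⟨⟩-trivial A⊆id π = mk⇔ (⟨⟩-least trivial-isSubgroup A⊆id) (λ π≈id → resp (λ i → sym (π≈id i)) one)
    where
    trivial-isSubgroup : IsSubgroup {n} (_≈ id)
    trivial-isSubgroup = record
      { ∈-resp = λ π≈σ π≈id i → trans (sym (π≈σ i)) (π≈id i)
      ; id-∈   = λ _ → refl
      ; ·-∈    = λ {π} {σ} → ·-cong {π = π} {id} {σ} {id}
      ; flip-∈ = λ {π} → flip-cong {π = π} {id}
      }

-- Faithful actions

-- Faithfulness forces associativity and the unit laws of (C, ∙), so only inverses are asked for.
record FaithfulAction (n : ℕ) (C : Set) (_∙_ : C → C → C) : Set where
  field
    act      : C → Fin n → Fin n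
    ε        : C
    _⁻¹      : C → C
    ⁻¹-∙     : ∀ x → (x ⁻¹) ∙ x ≡ ε
    ∙-⁻¹     : ∀ x → x ∙ (x ⁻¹) ≡ ε
    act-∙    : ∀ x y i → act (x ∙ y) i ≡ act x (act y i)
    act-ε    : ∀ i → act ε i ≡ i
    faithful : ∀ {x y} → (∀ i → act x i ≡ act y i) → x ≡ y

  act-cancel : ∀ x y → x ∙ y ≡ ε → ∀ i → act x (act y i) ≡ i
  act-cancel x y xy≡ε i = trans (sym (act-∙ x y i)) (trans (cong (λ z → act z i) xy≡ε) (act-ε i))

  idempotent⇒ε : ∀ {e} → e ∙ e ≡ e → e ≡ ε
  idempotent⇒ε {e} ee≡e = faithful λ i → begin
    act e i                       ≡⟨ act-cancel (e ⁻¹) e (⁻¹-∙ e) (act e i) ⟨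
    act (e ⁻¹) (act e (act e i))  ≡⟨ cong (act (e ⁻¹)) (trans (sym (act-∙ e e i)) (cong (λ z → act z i) ee≡e)) ⟩
    act (e ⁻¹) (act e i)          ≡⟨ act-cancel (e ⁻¹) e (⁻¹-∙ e) i ⟩
    i                             ≡⟨ act-ε i ⟨
    act ε i                       ∎
    where open ≡-Reasoning

  toPerm : C → Perm n
  toPerm x = permutation (act x) (act (x ⁻¹)) (act-cancel x (x ⁻¹) (∙-⁻¹ x)) (act-cancel (x ⁻¹) x (⁻¹-∙ x))

  toPerm-∙ : ∀ x y → toPerm (x ∙ y) ≈ toPerm x · toPerm y
  toPerm-∙ = act-∙

  module _ (A : Pred (Perm n) 0ℓ) where

    ⟨⟩-∙ : ∀ {x y} → ⟨ A ⟩ (toPerm x) → ⟨ A ⟩ (toPerm y) → ⟨ A ⟩ (toPerm (x ∙ y))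
    ⟨⟩-∙ {x} {y} p q = resp (λ i → sym (toPerm-∙ x y i)) (mul p q)

    ⟨⟩-ε : ⟨ A ⟩ (toPerm ε)
    ⟨⟩-ε = resp (λ i → sym (act-ε i)) one

    image-isSubgroup : IsSubgroup (λ π → ∃ λ x → toPerm x ≈ π)
    image-isSubgroup = record
      { ∈-resp = λ { π≈σ (x , x≈π) → x , λ i → trans (x≈π i) (π≈σ i) }
      ; id-∈   = ε , act-ε
      ; ·-∈    = λ { {π} {σ} (x , x≈π) (y , y≈σ) →
                     x ∙ y , λ i → trans (toPerm-∙ x y i) (·-cong {π = toPerm x} {π} {toPerm y} {σ} x≈π y≈σ i) }
      ; flip-∈ = λ { {π} (x , x≈π) → x ⁻¹ , flip-cong {π = toPerm x} {π} x≈π }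
      }

    ≅-generated : (∀ {π} → A π → ∃ λ x → toPerm x ≈ π) → (∀ x → ⟨ A ⟩ (toPerm x)) →
                  IsoTo ⟨ A ⟩ C _∙_
    ≅-generated A⊆image generated =
      toPerm , generated , (λ x y → faithful) , (λ π → ⟨⟩-least image-isSubgroup A⊆image) , toPerm-∙

module _ {n : ℕ} (b : Fin n → Fin n) (b-involutive : ∀ i → b (b i) ≡ i)
         {i₀ : Fin n} (b-moves-i₀ : b i₀ ≢ i₀) where

  involution-act : Zc 2 → Fin n → Fin n
  involution-act 0F i = i
  involution-act 1F i = b i

  involution : FaithfulAction n (Zc 2) Zmul
  involution = record
    { act      = involution-act
    ; ε        = 0F
    ; _⁻¹      = λ x → x
    ; ⁻¹-∙     = λ { 0F → refl ; 1F → refl }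
    ; ∙-⁻¹     = λ { 0F → refl ; 1F → refl }
    ; act-∙    = λ { 0F 0F i → refl ; 0F 1F i → refl ; 1F 0F i → refl ; 1F 1F i → sym (b-involutive i) }
    ; act-ε    = λ i → refl
    ; faithful = λ { {0F} {0F} _ → refl ; {1F} {1F} _ → refl
                   ; {0F} {1F} eq → ⊥-elim (b-moves-i₀ (sym (eq i₀))) ; {1F} {0F} eq → ⊥-elim (b-moves-i₀ (eq i₀)) }
    }

  involution-≅Z₂ : {A : Pred (Perm n) 0ℓ} →
                   (∀ {π} → A π → π ≈ id ⊎ π ≈ FaithfulAction.toPerm involution 1F) →
                   A (FaithfulAction.toPerm involution 1F) → ≅Z ⟨ A ⟩ 2
  involution-≅Z₂ {A} A-classified b∈A = ≅-generated A A⊆image generated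
    where
    open FaithfulAction involution
    A⊆image : ∀ {π} → A π → ∃ λ x → toPerm x ≈ π
    A⊆image π∈A with A-classified π∈A
    ... | inj₁ π≈id = 0F , λ i → sym (π≈id i)
    ... | inj₂ π≈b  = 1F , λ i → sym (π≈b i)
    generated : ∀ x → ⟨ A ⟩ (toPerm x)
    generated 0F = ⟨⟩-ε A
    generated 1F = gen b∈A

-- Cyclic and dihedral groups

module ℤ-mod (m : ℕ) where

  private
    N : ℕ
    N = suc m

  [m%n+k]%n≡[m+k]%n : ∀ x y → (x % N + y) % N ≡ (x + y) % N
  [m%n+k]%n≡[m+k]%n x y = begin
    (x % N + y) % N          ≡⟨ %-distribˡ-+ (x % N) y N ⟩
    (x % N % N + y % N) % N  ≡⟨ cong (λ z → (z + y % N) % N) (m%n%n≡m%n x N) ⟩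
    (x % N + y % N) % N      ≡⟨ %-distribˡ-+ x y N ⟨
    (x + y) % N              ∎
    where open ≡-Reasoning

  [m+k%n]%n≡[m+k]%n : ∀ x y → (x + y % N) % N ≡ (x + y) % N
  [m+k%n]%n≡[m+k]%n x y = begin
    (x + y % N) % N  ≡⟨ cong (_% N) (ℕ.+-comm x (y % N)) ⟩
    (y % N + x) % N  ≡⟨ [m%n+k]%n≡[m+k]%n y x ⟩
    (y + x) % N      ≡⟨ cong (_% N) (ℕ.+-comm y x) ⟩
    (x + y) % N      ∎
    where open ≡-Reasoning

  toℕ-⊕ : ∀ (i j : Fin N) → toℕ (i ⊕ j) ≡ (toℕ i + toℕ j) % N
  toℕ-⊕ i j = Fin.toℕ-fromℕ< _

  toℕ-⊖ : ∀ (i : Fin N) → toℕ (⊖ i) ≡ (N ∸ toℕ i) % N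
  toℕ-⊖ i = Fin.toℕ-fromℕ< _

  ⊕-assoc : ∀ (i j k : Fin N) → (i ⊕ j) ⊕ k ≡ i ⊕ (j ⊕ k)
  ⊕-assoc i j k = Fin.toℕ-injective (begin
    toℕ ((i ⊕ j) ⊕ k)                  ≡⟨ toℕ-⊕ (i ⊕ j) k ⟩
    (toℕ (i ⊕ j) + toℕ k) % N          ≡⟨ cong (λ z → (z + toℕ k) % N) (toℕ-⊕ i j) ⟩
    ((toℕ i + toℕ j) % N + toℕ k) % N  ≡⟨ [m%n+k]%n≡[m+k]%n (toℕ i + toℕ j) (toℕ k) ⟩
    (toℕ i + toℕ j + toℕ k) % N        ≡⟨ cong (_% N) (ℕ.+-assoc (toℕ i) (toℕ j) (toℕ k)) ⟩
    (toℕ i + (toℕ j + toℕ k)) % N      ≡⟨ [m+k%n]%n≡[m+k]%n (toℕ i) (toℕ j + toℕ k) ⟨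
    (toℕ i + (toℕ j + toℕ k) % N) % N  ≡⟨ cong (λ z → (toℕ i + z) % N) (toℕ-⊕ j k) ⟨
    (toℕ i + toℕ (j ⊕ k)) % N          ≡⟨ toℕ-⊕ i (j ⊕ k) ⟨
    toℕ (i ⊕ (j ⊕ k))                  ∎)
    where open ≡-Reasoning

  ⊕-comm : ∀ (i j : Fin N) → i ⊕ j ≡ j ⊕ i
  ⊕-comm i j = Fin.toℕ-injective (begin
    toℕ (i ⊕ j)          ≡⟨ toℕ-⊕ i j ⟩
    (toℕ i + toℕ j) % N  ≡⟨ cong (_% N) (ℕ.+-comm (toℕ i) (toℕ j)) ⟩
    (toℕ j + toℕ i) % N  ≡⟨ toℕ-⊕ j i ⟨
    toℕ (j ⊕ i)          ∎)
    where open ≡-Reasoning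

  ⊕-identityˡ : ∀ (i : Fin N) → 0F ⊕ i ≡ i
  ⊕-identityˡ i = Fin.toℕ-injective (trans (toℕ-⊕ 0F i) (m<n⇒m%n≡m (Fin.toℕ<n i)))

  ⊖-inverseˡ : ∀ (i : Fin N) → (⊖ i) ⊕ i ≡ 0F
  ⊖-inverseˡ i = Fin.toℕ-injective (begin
    toℕ ((⊖ i) ⊕ i)                ≡⟨ toℕ-⊕ (⊖ i) i ⟩
    (toℕ (⊖ i) + toℕ i) % N        ≡⟨ cong (λ z → (z + toℕ i) % N) (toℕ-⊖ i) ⟩
    ((N ∸ toℕ i) % N + toℕ i) % N  ≡⟨ [m%n+k]%n≡[m+k]%n (N ∸ toℕ i) (toℕ i) ⟩
    (N ∸ toℕ i + toℕ i) % N        ≡⟨ cong (_% N) (ℕ.m∸n+n≡m (ℕ.<⇒≤ (Fin.toℕ<n i))) ⟩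
    N % N                          ≡⟨ n%n≡0 N ⟩
    0                              ∎)
    where open ≡-Reasoning

  ⊕-abelianGroup : AbelianGroup 0ℓ 0ℓ
  ⊕-abelianGroup = record
    { Carrier = Fin N
    ; _≈_ = _≡_
    ; _∙_ = _⊕_
    ; ε = 0F
    ; _⁻¹ = ⊖_
    ; isAbelianGroup = record
      { isGroup = record
        { isMonoid = record
          { isSemigroup = record
            { isMagma = record { isEquivalence = ≡.isEquivalence ; ∙-cong = cong₂ _⊕_ }
            ; assoc = ⊕-assoc
            }
          ; identity = ⊕-identityˡ , λ i → trans (⊕-comm i 0F) (⊕-identityˡ i)
          }
        ; inverse = ⊖-inverseˡ , λ i → trans (⊕-comm i (⊖ i)) (⊖-inverseˡ i)
        ; ⁻¹-cong = cong ⊖_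
        }
      ; comm = ⊕-comm
      }
    }

  open AbelianGroup ⊕-abelianGroup public
    using () renaming (identityʳ to ⊕-identityʳ; inverseʳ to ⊖-inverseʳ)
  open import Algebra.Properties.AbelianGroup ⊕-abelianGroup public
    using (inverseˡ-unique)
    renaming (⁻¹-∙-comm to ⊖-⊕-distrib; ⁻¹-involutive to ⊖-involutive; ε⁻¹≈ε to ⊖0≡0;
              ∙-cancelˡ to ⊕-cancelˡ; //-rightDividesˡ to ⊖-⊕-cancel; //-rightDividesʳ to ⊕-⊖-cancel)

  1ₘ : Fin N
  1ₘ = 1 mod N

  toℕ-1ₘ : toℕ 1ₘ ≡ 1 % N
  toℕ-1ₘ = Fin.toℕ-fromℕ< (m%n<n 1 N)

  ⊕-induction : (P : Fin N → Set) → P 0F → (∀ i → P i → P (1ₘ ⊕ i)) → ∀ i → P i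
  ⊕-induction P P0 P-step i = subst P i-mod-N≡i (P-mod (toℕ i))
    where
    P-mod : ∀ k → P (k mod N)
    P-mod zero    = P0
    P-mod (suc k) = subst P (Fin.toℕ-injective (begin
      toℕ (1ₘ ⊕ (k mod N))            ≡⟨ toℕ-⊕ 1ₘ (k mod N) ⟩
      (toℕ 1ₘ + toℕ (k mod N)) % N    ≡⟨ cong₂ (λ x y → (x + y) % N) toℕ-1ₘ (Fin.toℕ-fromℕ< (m%n<n k N)) ⟩
      (1 % N + k % N) % N             ≡⟨ %-distribˡ-+ 1 k N ⟨
      suc k % N                       ≡⟨ Fin.toℕ-fromℕ< _ ⟨
      toℕ (suc k mod N)               ∎)) (P-step _ (P-mod k))
      where open ≡-Reasoning
    i-mod-N≡i : toℕ i mod N ≡ i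
    i-mod-N≡i = Fin.toℕ-injective (trans (Fin.toℕ-fromℕ< _) (m<n⇒m%n≡m (Fin.toℕ<n i)))

  last : Fin N
  last = fromℕ m

  last-view : ∀ i → i <ᶠ last ⊎ i ≡ last
  last-view i with ℕ.m≤n⇒m<n∨m≡n (s≤s⁻¹ (Fin.toℕ<n i))
  ... | inj₁ i<m = inj₁ (subst (toℕ i <_) (sym (Fin.toℕ-fromℕ m)) i<m)
  ... | inj₂ i≡m = inj₂ (Fin.toℕ-injective (trans i≡m (sym (Fin.toℕ-fromℕ m))))

  toℕ-1ₘ⊕ : ∀ i → i <ᶠ last → toℕ (1ₘ ⊕ i) ≡ suc (toℕ i)
  toℕ-1ₘ⊕ i i<last = begin
    toℕ (1ₘ ⊕ i)               ≡⟨ toℕ-⊕ 1ₘ i ⟩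
    (toℕ 1ₘ + toℕ i) % N       ≡⟨ cong (λ x → (x + toℕ i) % N) toℕ-1ₘ ⟩
    (1 % N + toℕ i) % N        ≡⟨ [m%n+k]%n≡[m+k]%n 1 (toℕ i) ⟩
    suc (toℕ i) % N            ≡⟨ m<n⇒m%n≡m (s<s (subst (toℕ i <_) (Fin.toℕ-fromℕ m) i<last)) ⟩
    suc (toℕ i)                ∎
    where open ≡-Reasoning

  1ₘ⊕last : 1ₘ ⊕ last ≡ 0F
  1ₘ⊕last = Fin.toℕ-injective (begin
    toℕ (1ₘ ⊕ last)            ≡⟨ toℕ-⊕ 1ₘ last ⟩
    (toℕ 1ₘ + toℕ last) % N    ≡⟨ cong₂ (λ x y → (x + y) % N) toℕ-1ₘ (Fin.toℕ-fromℕ m) ⟩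
    (1 % N + m) % N            ≡⟨ [m%n+k]%n≡[m+k]%n 1 m ⟩
    N % N                      ≡⟨ n%n≡0 N ⟩
    0                          ∎)
    where open ≡-Reasoning

  ⊖last≡1ₘ : ⊖ last ≡ 1ₘ
  ⊖last≡1ₘ = sym (inverseˡ-unique 1ₘ last 1ₘ⊕last)

  opposite-⊕ : ∀ i → opposite i ⊕ i ≡ last
  opposite-⊕ i = Fin.toℕ-injective (begin
    toℕ (opposite i ⊕ i)           ≡⟨ toℕ-⊕ (opposite i) i ⟩
    (toℕ (opposite i) + toℕ i) % N  ≡⟨ cong (λ k → (k + toℕ i) % N) (Fin.opposite-prop i) ⟩
    (m ∸ toℕ i + toℕ i) % N         ≡⟨ cong (_% N) (ℕ.m∸n+n≡m (s≤s⁻¹ (Fin.toℕ<n i))) ⟩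
    m % N                           ≡⟨ m<n⇒m%n≡m (ℕ.n<1+n m) ⟩
    m                               ≡⟨ Fin.toℕ-fromℕ m ⟨
    toℕ last                        ∎)
    where open ≡-Reasoning

  last⊕⊖≡opposite : ∀ i → last ⊕ (⊖ i) ≡ opposite i
  last⊕⊖≡opposite i = trans (cong (_⊕ (⊖ i)) (sym (opposite-⊕ i))) (⊕-⊖-cancel i (opposite i))

  module _ {n : ℕ} (R : FaithfulAction n (Fin N) _⊕_) (A : Pred (Perm n) 0ℓ) where
    open FaithfulAction R

    ⟨⟩-cyclic : ⟨ A ⟩ (toPerm 1ₘ) → ∀ x → ⟨ A ⟩ (toPerm x)
    ⟨⟩-cyclic 1ₘ∈A = ⊕-induction (λ x → ⟨ A ⟩ (toPerm x)) 0∈A (λ x → ⟨⟩-∙ A 1ₘ∈A)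
      where
      0∈A : ⟨ A ⟩ (toPerm 0F)
      0∈A = subst (λ x → ⟨ A ⟩ (toPerm x)) (sym (idempotent⇒ε (⊕-identityˡ 0F))) (⟨⟩-ε A)

translation : (m : ℕ) → FaithfulAction (suc m) (Zc (suc m)) Zmul
translation m = record
  { act      = _⊕_
  ; ε        = 0F
  ; _⁻¹      = ⊖_
  ; ⁻¹-∙     = ⊖-inverseˡ
  ; ∙-⁻¹     = ⊖-inverseʳ
  ; act-∙    = ⊕-assoc
  ; act-ε    = ⊕-identityˡ
  ; faithful = λ {x} {y} eq → trans (sym (⊕-identityʳ x)) (trans (eq 0F) (⊕-identityʳ y))
  }
  where open ℤ-mod m

module Dihedral (m : ℕ) where

  open ℤ-mod (2 + m)

  private
    N : ℕ
    N = 3 + m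

  reflectIf : Bool → Fin N → Fin N
  reflectIf b i = if b then ⊖ i else i

  affine : Dc N → Fin N → Fin N
  affine (k , b) i = k ⊕ reflectIf b i

  reflectIf-⊕ : ∀ b i j → reflectIf b (i ⊕ j) ≡ reflectIf b i ⊕ reflectIf b j
  reflectIf-⊕ false i j = refl
  reflectIf-⊕ true  i j = sym (⊖-⊕-distrib i j)

  reflectIf-xor : ∀ b c i → reflectIf (b xor c) i ≡ reflectIf b (reflectIf c i)
  reflectIf-xor false c     i = refl
  reflectIf-xor true  false i = refl
  reflectIf-xor true  true  i = sym (⊖-involutive i)

  affine-∙ : ∀ x y i → affine (Dmul x y) i ≡ affine x (affine y i)
  affine-∙ (k , b) (j , c) i = begin
    (k ⊕ reflectIf b j) ⊕ reflectIf (b xor c) i        ≡⟨ ⊕-assoc k _ _ ⟩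
    k ⊕ (reflectIf b j ⊕ reflectIf (b xor c) i)        ≡⟨ cong (λ z → k ⊕ (reflectIf b j ⊕ z)) (reflectIf-xor b c i) ⟩
    k ⊕ (reflectIf b j ⊕ reflectIf b (reflectIf c i))  ≡⟨ cong (k ⊕_) (reflectIf-⊕ b j (reflectIf c i)) ⟨
    k ⊕ reflectIf b (j ⊕ reflectIf c i)                ∎
    where open ≡-Reasoning

  _⁻¹ᴰ : Dc N → Dc N
  (k , false) ⁻¹ᴰ = ⊖ k , false
  (k , true)  ⁻¹ᴰ = k , true

  1≢⊖1 : 1F ≢ ⊖ 1F
  1≢⊖1 1≡⊖1 with trans (cong toℕ 1≡⊖1) (trans (toℕ-⊖ 1F) (m<n⇒m%n≡m (ℕ.n<1+n (2 + m))))
  ... | ()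

  affine-0 : ∀ k b → affine (k , b) 0F ≡ k
  affine-0 k false = ⊕-identityʳ k
  affine-0 k true  = trans (cong (k ⊕_) ⊖0≡0) (⊕-identityʳ k)

  reflectIf-1-injective : ∀ b c → reflectIf b 1F ≡ reflectIf c 1F → b ≡ c
  reflectIf-1-injective false false _    = refl
  reflectIf-1-injective true  true  _    = refl
  reflectIf-1-injective false true  1≡⊖1 = ⊥-elim (1≢⊖1 1≡⊖1)
  reflectIf-1-injective true  false ⊖1≡1 = ⊥-elim (1≢⊖1 (sym ⊖1≡1))

  affine-faithful : ∀ {x y} → (∀ i → affine x i ≡ affine y i) → x ≡ y
  affine-faithful {k , b} {j , c} eq with trans (sym (affine-0 k b)) (trans (eq 0F) (affine-0 j c))
  ... | refl = cong (k ,_) (reflectIf-1-injective b c (⊕-cancelˡ k _ _ (eq 1F)))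

  dihedral : FaithfulAction N (Dc N) Dmul
  dihedral = record
    { act      = affine
    ; ε        = 0F , false
    ; _⁻¹      = _⁻¹ᴰ
    ; ⁻¹-∙     = λ { (k , false) → cong (_, false) (⊖-inverseˡ k) ; (k , true) → cong (_, false) (⊖-inverseʳ k) }
    ; ∙-⁻¹     = λ { (k , false) → cong (_, false) (⊖-inverseʳ k) ; (k , true) → cong (_, false) (⊖-inverseʳ k) }
    ; act-∙    = affine-∙
    ; act-ε    = ⊕-identityˡ
    ; faithful = affine-faithful
    }

  module _ {n : ℕ} (R : FaithfulAction n (Dc N) Dmul) (A : Pred (Perm n) 0ℓ) where
    open FaithfulAction R

    ⟨⟩-dihedral : ∀ {j} → ⟨ A ⟩ (toPerm (1ₘ , false)) → ⟨ A ⟩ (toPerm (j , true)) →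
                  ∀ x → ⟨ A ⟩ (toPerm x)
    ⟨⟩-dihedral {j} rotation∈A reflection∈A (k , false) = rotations k
      where
      0∈A : ⟨ A ⟩ (toPerm (0F , false))
      0∈A = subst (λ x → ⟨ A ⟩ (toPerm x)) (sym (idempotent⇒ε (cong (_, false) (⊕-identityˡ 0F)))) (⟨⟩-ε A)
      rotations : ∀ k → ⟨ A ⟩ (toPerm (k , false))
      rotations = ⊕-induction (λ k → ⟨ A ⟩ (toPerm (k , false))) 0∈A (λ k → ⟨⟩-∙ A rotation∈A)
    ⟨⟩-dihedral {j} rotation∈A reflection∈A (k , true) =
      subst (λ z → ⟨ A ⟩ (toPerm (z , true))) (⊖-⊕-cancel j k)
        (⟨⟩-∙ A (⟨⟩-dihedral rotation∈A reflection∈A (k ⊕ (⊖ j) , false)) reflection∈A)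

module Dihedral₄OnEnds (m : ℕ) where

  open Dihedral 1 using (affine; dihedral)
  open FaithfulAction dihedral using (_⁻¹; ⁻¹-∙; ∙-⁻¹) renaming (faithful to affine-faithful)
  open ℤ-mod 3 using (⊕-identityˡ)

  -- The four ends carry labels in Z₄ going round a square: 0 and 2 are the (0-based) positions
  -- 0 and 1 on the left, 1 and 3 the positions n−2 and n−1 on the right. Reversal is x ↦ 3 − x
  -- on labels, and an end lies on the right exactly when its label is odd.
  end : Fin 4 → Fin (4 + m)
  end 0F = 0F
  end 1F = opposite 1F
  end 2F = 1F
  end 3F = opposite 0F

  endℕ : Fin 4 → ℕ
  endℕ 0F = 0
  endℕ 1F = 2 + m
  endℕ 2F = 1
  endℕ 3F = 3 + m

  toℕ-end : ∀ c → toℕ (end c) ≡ endℕ c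
  toℕ-end 0F = refl
  toℕ-end 1F = Fin.opposite-prop 1F
  toℕ-end 2F = refl
  toℕ-end 3F = Fin.opposite-prop 0F

  endℕ-injective : ∀ c d → endℕ c ≡ endℕ d → c ≡ d
  endℕ-injective 0F 0F _  = refl
  endℕ-injective 1F 1F _  = refl
  endℕ-injective 2F 2F _  = refl
  endℕ-injective 3F 3F _  = refl
  endℕ-injective 1F 3F eq = ⊥-elim (ℕ.1+n≢n (sym eq))
  endℕ-injective 3F 1F eq = ⊥-elim (ℕ.1+n≢n eq)
  endℕ-injective 0F 1F ()
  endℕ-injective 0F 2F ()
  endℕ-injective 0F 3F ()
  endℕ-injective 1F 0F ()
  endℕ-injective 1F 2F ()
  endℕ-injective 2F 0F ()
  endℕ-injective 2F 1F ()
  endℕ-injective 2F 3F ()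
  endℕ-injective 3F 0F ()
  endℕ-injective 3F 2F ()

  end-injective : ∀ {c d} → end c ≡ end d → c ≡ d
  end-injective {c} {d} eq = endℕ-injective c d (trans (sym (toℕ-end c)) (trans (cong toℕ eq) (toℕ-end d)))

  IsMiddle : Fin (4 + m) → Set
  IsMiddle i = 2 ≤ toℕ i × toℕ i < 2 + m

  end-not-middle : ∀ c → ¬ IsMiddle (end c)
  end-not-middle c (2≤c , c<2+m) with toℕ-end c
  end-not-middle 0F (() , _)     | _
  end-not-middle 2F (s≤s () , _) | _
  end-not-middle 1F (_ , c<2+m)  | eq = ℕ.<-irrefl eq c<2+m
  end-not-middle 3F (_ , c<2+m)  | eq = ℕ.<-asym (subst (_< 2 + m) eq c<2+m) (ℕ.n<1+n (2 + m))

  opposite-middle : ∀ {i} → IsMiddle i → IsMiddle (opposite i)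
  opposite-middle {i} (2≤i , i<2+m) =
    subst (2 ≤_) (sym (Fin.opposite-prop i)) lower , subst (_< 2 + m) (sym (Fin.opposite-prop i)) upper
    where
    lower : 2 ≤ 3 + m ∸ toℕ i
    lower = subst (_≤ 3 + m ∸ toℕ i) (ℕ.m+n∸n≡m 2 (suc m)) (ℕ.∸-monoʳ-≤ (3 + m) (s≤s⁻¹ i<2+m))
    upper : 3 + m ∸ toℕ i < 2 + m
    upper = s≤s (ℕ.∸-monoʳ-≤ (3 + m) 2≤i)

  Region : Fin (4 + m) → Set
  Region i = (∃ λ c → end c ≡ i) ⊎ IsMiddle i

  region : ∀ i → Region i
  region 0F = inj₁ (0F , refl)
  region 1F = inj₁ (2F , refl)
  region (suc (suc j)) with ℕ.<-cmp (toℕ j) m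
  ... | tri< j<m _ _ = inj₂ (s≤s (s≤s z≤n) , s<s (s<s j<m))
  ... | tri≈ _ j≡m _ = inj₁ (1F , Fin.toℕ-injective (trans (toℕ-end 1F) (cong (2 +_) (sym j≡m))))
  ... | tri> _ _ m<j = inj₁ (3F , Fin.toℕ-injective (trans (toℕ-end 3F)
                          (cong (2 +_) (ℕ.≤-antisym m<j (s≤s⁻¹ (Fin.toℕ<n j))))))

  oppositeIf : Bool → Fin (4 + m) → Fin (4 + m)
  oppositeIf b i = if b then opposite i else i

  oppositeIf-xor : ∀ b c i → oppositeIf (b xor c) i ≡ oppositeIf b (oppositeIf c i)
  oppositeIf-xor false c     i = refl
  oppositeIf-xor true  false i = refl
  oppositeIf-xor true  true  i = sym (Fin.opposite-involutive i)

  oppositeIf-middle : ∀ b {i} → IsMiddle i → IsMiddle (oppositeIf b i)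
  oppositeIf-middle false mid = mid
  oppositeIf-middle true  mid = opposite-middle mid

  isOdd : Fin 4 → Bool
  isOdd 0F = false
  isOdd 1F = true
  isOdd 2F = false
  isOdd 3F = true

  swapsSides : Dc 4 → Bool
  swapsSides (k , _) = isOdd k

  swapsSides-∙ : ∀ x y → swapsSides (Dmul x y) ≡ swapsSides x xor swapsSides y
  swapsSides-∙ (k , false) (j , _) = isOdd-⊕ k j
    where
    isOdd-⊕ : ∀ (k j : Fin 4) → isOdd (k ⊕ j) ≡ isOdd k xor isOdd j
    isOdd-⊕ = from-yes (Fin.all? λ k → Fin.all? λ j → isOdd (k ⊕ j) Bool.≟ isOdd k xor isOdd j)
  swapsSides-∙ (k , true) (j , _) = isOdd-⊕⊖ k j
    where
    isOdd-⊕⊖ : ∀ (k j : Fin 4) → isOdd (k ⊕ (⊖ j)) ≡ isOdd k xor isOdd j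
    isOdd-⊕⊖ = from-yes (Fin.all? λ k → Fin.all? λ j → isOdd (k ⊕ (⊖ j)) Bool.≟ isOdd k xor isOdd j)

  onRegion : Dc 4 → ∀ i → Region i → Fin (4 + m)
  onRegion x i (inj₁ (c , _)) = end (affine x c)
  onRegion x i (inj₂ _)       = oppositeIf (swapsSides x) i

  onRegion-irrelevant : ∀ x i (r r′ : Region i) → onRegion x i r ≡ onRegion x i r′
  onRegion-irrelevant x i (inj₁ (c , c↦i)) (inj₁ (d , d↦i)) =
    cong (end ∘ affine x) (end-injective (trans c↦i (sym d↦i)))
  onRegion-irrelevant x i (inj₁ (c , refl)) (inj₂ mid) = ⊥-elim (end-not-middle c mid)
  onRegion-irrelevant x i (inj₂ mid) (inj₁ (c , refl)) = ⊥-elim (end-not-middle c mid)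
  onRegion-irrelevant x i (inj₂ _)   (inj₂ _)          = refl

  act₄ : Dc 4 → Fin (4 + m) → Fin (4 + m)
  act₄ x i = onRegion x i (region i)

  act₄-end : ∀ x c → act₄ x (end c) ≡ end (affine x c)
  act₄-end x c = onRegion-irrelevant x (end c) (region (end c)) (inj₁ (c , refl))

  act₄-middle : ∀ x {i} → IsMiddle i → act₄ x i ≡ oppositeIf (swapsSides x) i
  act₄-middle x {i} mid = onRegion-irrelevant x i (region i) (inj₂ mid)

  act₄-∙ : ∀ x y i → act₄ (Dmul x y) i ≡ act₄ x (act₄ y i)
  act₄-∙ x y i with region i
  ... | inj₁ (c , refl) = begin
    end (affine (Dmul x y) c)       ≡⟨ cong end (FaithfulAction.act-∙ dihedral x y c) ⟩
    end (affine x (affine y c))     ≡⟨ act₄-end x (affine y c) ⟨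
    act₄ x (end (affine y c))       ∎
    where open ≡-Reasoning
  ... | inj₂ mid = begin
    oppositeIf (swapsSides (Dmul x y)) i                    ≡⟨ cong (λ b → oppositeIf b i) (swapsSides-∙ x y) ⟩
    oppositeIf (swapsSides x xor swapsSides y) i            ≡⟨ oppositeIf-xor (swapsSides x) (swapsSides y) i ⟩
    oppositeIf (swapsSides x) (oppositeIf (swapsSides y) i) ≡⟨ act₄-middle x (oppositeIf-middle (swapsSides y) mid) ⟨
    act₄ x (oppositeIf (swapsSides y) i)                    ∎
    where open ≡-Reasoning

  act₄-ε : ∀ i → act₄ (0F , false) i ≡ i
  act₄-ε i with region i
  ... | inj₁ (c , refl) = cong end (⊕-identityˡ c)
  ... | inj₂ mid        = refl

  D₄-action : FaithfulAction (4 + m) (Dc 4) Dmul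
  D₄-action = record
    { act      = act₄
    ; ε        = 0F , false
    ; _⁻¹      = _⁻¹
    ; ⁻¹-∙     = ⁻¹-∙
    ; ∙-⁻¹     = ∙-⁻¹
    ; act-∙    = act₄-∙
    ; act-ε    = act₄-ε
    ; faithful = λ {x} {y} eq → affine-faithful λ c →
        end-injective (trans (sym (act₄-end x c)) (trans (eq (end c)) (act₄-end y c)))
    }

-- Patterns of length three

data S₃ : Set where
  τ123 τ132 τ213 τ231 τ312 τ321 : S₃

perm₃ : S₃ → Perm 3
perm₃ τ123 = proj₂ p123
perm₃ τ132 = proj₂ p132
perm₃ τ213 = proj₂ p213
perm₃ τ231 = proj₂ p231
perm₃ τ312 = proj₂ p312
perm₃ τ321 = proj₂ p321

toPattern : S₃ → Pattern
toPattern t = 3 , perm₃ t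

Av₃ : (n : ℕ) → List S₃ → Pred (Perm n) 0ℓ
Av₃ n ts = Av n ⟦ map toPattern ts ⟧

triple : {A : Set} → A → A → A → Fin 3 → A
triple x y z 0F = x
triple x y z 1F = y
triple x y z 2F = z

triple-η : {A : Set} (f : Fin 3 → A) → ∀ k → triple (f 0F) (f 1F) (f 2F) k ≡ f k
triple-η f 0F = refl
triple-η f 1F = refl
triple-η f 2F = refl

increasing₃ : ∀ {n} (u : Fin 3 → Fin n) → u 0F <ᶠ u 1F → u 1F <ᶠ u 2F → ∀ {i j} → i <ᶠ j → u i <ᶠ u j
increasing₃ u p q {0F} {1F} _ = p
increasing₃ u p q {0F} {2F} _ = Fin.<-trans p q
increasing₃ u p q {1F} {2F} _ = q
increasing₃ u p q {0F} {0F} ()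
increasing₃ u p q {1F} {0F} ()
increasing₃ u p q {1F} {1F} (s≤s ())
increasing₃ u p q {2F} {0F} ()
increasing₃ u p q {2F} {1F} (s≤s ())
increasing₃ u p q {2F} {2F} (s≤s (s≤s ()))

-- u ∘ τ⁻¹ is increasing. For a concrete τ this unfolds to its two defining inequalities,
-- e.g. to u 0 < u 2 × u 2 < u 1 for τ = 132.
Realises : ∀ {n} → Perm 3 → (Fin 3 → Fin n) → Set
Realises τ u = u (τ ⟨$⟩ˡ 0F) <ᶠ u (τ ⟨$⟩ˡ 1F) × u (τ ⟨$⟩ˡ 1F) <ᶠ u (τ ⟨$⟩ˡ 2F)

OccursAt : ∀ {n} → Perm 3 → Perm n → Fin n → Fin n → Fin n → Set
OccursAt τ π a b c = Realises τ ((π ⟨$⟩ʳ_) ∘ triple a b c)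

module _ {n : ℕ} (π : Perm n) (τ : Perm 3) where

  contains₃ : ∀ {a b c} → a <ᶠ b → b <ᶠ c → OccursAt τ π a b c → Contains π τ
  contains₃ {a} {b} {c} a<b b<c (p , q) =
    f , (λ i j → increasing₃ f a<b b<c) , λ i j → mk⇔ (reflect i j) (preserve i j)
    where
    f : Fin 3 → Fin n
    f = triple a b c
    preserve : ∀ i j → τ ⟨$⟩ʳ i <ᶠ τ ⟨$⟩ʳ j → π ⟨$⟩ʳ f i <ᶠ π ⟨$⟩ʳ f j
    preserve i j τi<τj = subst₂ (λ k l → π ⟨$⟩ʳ f k <ᶠ π ⟨$⟩ʳ f l) (inverseˡ τ) (inverseˡ τ)
      (increasing₃ (λ k → π ⟨$⟩ʳ f (τ ⟨$⟩ˡ k)) p q τi<τj)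
    reflect : ∀ i j → π ⟨$⟩ʳ f i <ᶠ π ⟨$⟩ʳ f j → τ ⟨$⟩ʳ i <ᶠ τ ⟨$⟩ʳ j
    reflect i j πi<πj with Fin.<-cmp (τ ⟨$⟩ʳ i) (τ ⟨$⟩ʳ j)
    ... | tri< lt _ _ = lt
    ... | tri≈ _ eq _ = ⊥-elim (Fin.<-irrefl (cong (λ k → π ⟨$⟩ʳ f k) (injective τ eq)) πi<πj)
    ... | tri> _ _ gt = ⊥-elim (Fin.<-asym πi<πj (preserve j i gt))

  occurrence : Contains π τ → ∃ λ a → ∃ λ b → ∃ λ c → a <ᶠ b × b <ᶠ c × OccursAt τ π a b c
  occurrence (f , f-inc , f-iso) =
    f 0F , f 1F , f 2F , f-inc 0F 1F z<s , f-inc 1F 2F (s<s z<s) , step 0F 1F z<s , step 1F 2F (s<s z<s)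
    where
    u : Fin 3 → Fin n
    u = (π ⟨$⟩ʳ_) ∘ triple (f 0F) (f 1F) (f 2F)
    step : ∀ k l → k <ᶠ l → u (τ ⟨$⟩ˡ k) <ᶠ u (τ ⟨$⟩ˡ l)
    step k l k<l = subst₂ _<ᶠ_ (cong (π ⟨$⟩ʳ_) (sym (triple-η f _))) (cong (π ⟨$⟩ʳ_) (sym (triple-η f _)))
      (Equivalence.from (f-iso (τ ⟨$⟩ˡ k) (τ ⟨$⟩ˡ l)) (subst₂ _<ᶠ_ (sym (inverseʳ τ)) (sym (inverseʳ τ)) k<l))

module _ {n : ℕ} (π : Perm n) where

  orderType : ∀ {a b c} → a <ᶠ b → b <ᶠ c → Σ S₃ λ t → OccursAt (perm₃ t) π a b c
  orderType {a} {b} {c} a<b b<c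
    with Fin.<-cmp (π ⟨$⟩ʳ a) (π ⟨$⟩ʳ b)
       | Fin.<-cmp (π ⟨$⟩ʳ b) (π ⟨$⟩ʳ c)
       | Fin.<-cmp (π ⟨$⟩ʳ a) (π ⟨$⟩ʳ c)
  ... | tri≈ _ ab _ | _ | _ = ⊥-elim (Fin.<⇒≢ a<b (injective π ab))
  ... | _ | tri≈ _ bc _ | _ = ⊥-elim (Fin.<⇒≢ b<c (injective π bc))
  ... | _ | _ | tri≈ _ ac _ = ⊥-elim (Fin.<⇒≢ (Fin.<-trans a<b b<c) (injective π ac))
  ... | tri< ab _ _ | tri< bc _ _ | _           = τ123 , ab , bc
  ... | tri< _ _ _  | tri> _ _ cb | tri< ac _ _ = τ132 , ac , cb
  ... | tri< ab _ _ | tri> _ _ _  | tri> _ _ ca = τ231 , ca , ab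
  ... | tri> _ _ ba | tri< _ _ _  | tri< ac _ _ = τ213 , ba , ac
  ... | tri> _ _ _  | tri< bc _ _ | tri> _ _ ca = τ312 , bc , ca
  ... | tri> _ _ ba | tri> _ _ cb | _           = τ321 , cb , ba

  avoids₃ : ∀ τ → (∀ a b c → a <ᶠ b → b <ᶠ c → ¬ OccursAt τ π a b c) → Avoids π τ
  avoids₃ τ no-occurrence C with occurrence π τ C
  ... | a , b , c , a<b , b<c , occ = no-occurrence a b c a<b b<c occ

  triple-type : ∀ {ts as} → (∀ t → t ∈ ts ⊎ t ∈ as) → Av₃ n ts π →
                ∀ a b c → a <ᶠ b → b <ᶠ c → Any (λ t → OccursAt (perm₃ t) π a b c) as
  triple-type cover av a b c a<b b<c with orderType a<b b<c
  ... | t , occ with cover t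
  ...   | inj₁ t∈ts = ⊥-elim (av (toPattern t) (∈-map⁺ toPattern t∈ts) (contains₃ π (perm₃ t) a<b b<c occ))
  ...   | inj₂ t∈as = lose t∈as occ

module _ {n : ℕ} {π : Perm n} {ts : List S₃} where

  Av₃⇒All : Av₃ n ts π → All (λ t → Avoids π (perm₃ t)) ts
  Av₃⇒All av = All.map⁻ (All.tabulate {P = λ p → Avoids π (proj₂ p)} (λ {p} → av p))

  All⇒Av₃ : All (λ t → Avoids π (perm₃ t)) ts → Av₃ n ts π
  All⇒Av₃ avs p = All.lookup (All.map⁺ {P = λ p → Avoids π (proj₂ p)} avs)

contains-resp : ∀ {n k} {π π′ : Perm n} {τ τ′ : Perm k} → π ≈ π′ → τ ≈ τ′ →
                Contains π τ → Contains π′ τ′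
contains-resp π≈π′ τ≈τ′ (f , f-inc , f-iso) = f , f-inc , λ i j → mk⇔
  (λ lt → subst₂ _<ᶠ_ (τ≈τ′ i) (τ≈τ′ j)
    (Equivalence.to (f-iso i j) (subst₂ _<ᶠ_ (sym (π≈π′ (f i))) (sym (π≈π′ (f j))) lt)))
  (λ lt → subst₂ _<ᶠ_ (π≈π′ (f i)) (π≈π′ (f j))
    (Equivalence.from (f-iso i j) (subst₂ _<ᶠ_ (sym (τ≈τ′ i)) (sym (τ≈τ′ j)) lt)))

Av-resp : ∀ {n} {T : Pred Pattern 0ℓ} {π σ : Perm n} → π ≈ σ → Av n T π → Av n T σ
Av-resp {π = π} {σ} π≈σ av p p∈T C =
  av p p∈T (contains-resp {π = σ} {π} {proj₂ p} {proj₂ p} (λ i → sym (π≈σ i)) (λ _ → refl) C)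

module _ {n : ℕ} (σ : Perm n) (σ-dec : Decreasing σ) where

  decreasing⇒avoids : ∀ t → t ≢ τ321 → Avoids σ (perm₃ t)
  decreasing⇒avoids τ123 _ = avoids₃ σ (perm₃ τ123) λ a b c a<b _ (ab , _) → Fin.<-asym ab (σ-dec a b a<b)
  decreasing⇒avoids τ132 _ = avoids₃ σ (perm₃ τ132) λ a b c a<b b<c (ac , _) →
    Fin.<-asym ac (σ-dec a c (Fin.<-trans a<b b<c))
  decreasing⇒avoids τ213 _ = avoids₃ σ (perm₃ τ213) λ a b c a<b b<c (_ , ac) →
    Fin.<-asym ac (σ-dec a c (Fin.<-trans a<b b<c))
  decreasing⇒avoids τ231 _ = avoids₃ σ (perm₃ τ231) λ a b c a<b _ (_ , ab) → Fin.<-asym ab (σ-dec a b a<b)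
  decreasing⇒avoids τ312 _ = avoids₃ σ (perm₃ τ312) λ a b c _ b<c (bc , _) → Fin.<-asym bc (σ-dec b c b<c)
  decreasing⇒avoids τ321 τ321≢τ321 = ⊥-elim (τ321≢τ321 refl)

  decreasing⇒Av₃ : ∀ ts → All (_≢ τ321) ts → Av₃ n ts σ
  decreasing⇒Av₃ ts ts∌321 = All⇒Av₃ {π = σ} (All.map (λ {t} → decreasing⇒avoids t) ts∌321)

triples⇒pairs : ∀ {m} (R : Fin (3 + m) → Fin (3 + m) → Set) →
                (∀ a b c → a <ᶠ b → b <ᶠ c → R a b × R a c × R b c) → ∀ i j → i <ᶠ j → R i j
triples⇒pairs R R₃ (suc i) j             i<j = proj₂ (proj₂ (R₃ 0F (suc i) j z<s i<j))
triples⇒pairs R R₃ 0F      1F            _   = proj₁ (R₃ 0F 1F 2F z<s (s<s z<s))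
triples⇒pairs R R₃ 0F      (suc (suc j)) _   = proj₁ (proj₂ (R₃ 0F 1F (suc (suc j)) z<s (s<s z<s)))

swap₀₁ : ∀ {m} → Fin (2 + m) → Fin (2 + m)
swap₀₁ 0F            = 1F
swap₀₁ 1F            = 0F
swap₀₁ (suc (suc i)) = suc (suc i)

swap₀₁-involutive : ∀ {m} (i : Fin (2 + m)) → swap₀₁ (swap₀₁ i) ≡ i
swap₀₁-involutive 0F            = refl
swap₀₁-involutive 1F            = refl
swap₀₁-involutive (suc (suc i)) = refl

swap₀₁-last-largest : ∀ {m} (a b c : Fin (2 + m)) → a <ᶠ b → b <ᶠ c →
                      swap₀₁ a <ᶠ swap₀₁ c × swap₀₁ b <ᶠ swap₀₁ c
swap₀₁-last-largest a b       (suc (suc c)) a<b b<c = below-last a (Fin.<-trans a<b b<c) , below-last b b<c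
  where
  below-last : ∀ i → i <ᶠ suc (suc c) → swap₀₁ i <ᶠ suc (suc c)
  below-last 0F            _   = s<s z<s
  below-last 1F            _   = z<s
  below-last (suc (suc i)) i<c = i<c
swap₀₁-last-largest a 0F      1F () _
swap₀₁-last-largest a (suc b) 1F _ (s≤s ())

-- Reverse-complement

rc : ∀ {n} → Perm n → Perm n
rc π = reverse · π · reverse

module _ {n : ℕ} where

  rc-cong : ∀ {π σ : Perm n} → π ≈ σ → rc π ≈ rc σ
  rc-cong π≈σ i = cong opposite (π≈σ (opposite i))

  rc-· : (π σ : Perm n) → rc (π · σ) ≈ rc π · rc σ
  rc-· π σ i = cong (opposite ∘ (π ⟨$⟩ʳ_)) (sym (Fin.opposite-involutive (σ ⟨$⟩ʳ opposite i)))

  rc-involutive : (π : Perm n) → rc (rc π) ≈ π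
  rc-involutive π i = trans (Fin.opposite-involutive _) (cong (π ⟨$⟩ʳ_) (Fin.opposite-involutive i))

  rc-opposite : (π : Perm n) (i : Fin n) → rc π ⟨$⟩ʳ opposite i ≡ opposite (π ⟨$⟩ʳ i)
  rc-opposite π i = cong (opposite ∘ (π ⟨$⟩ʳ_)) (Fin.opposite-involutive i)

  ⟨⟩-rc : {A B : Pred (Perm n) 0ℓ} → (∀ {π} → A π → B (rc π)) → ∀ {π} → ⟨ A ⟩ π → ⟨ B ⟩ (rc π)
  ⟨⟩-rc {A} {B} A⇒B = ⟨⟩-least rc-preimage (gen ∘ A⇒B)
    where
    rc-preimage : IsSubgroup (λ π → ⟨ B ⟩ (rc π))
    rc-preimage = record
      { ∈-resp = λ {π} {σ} π≈σ → resp (rc-cong {π} {σ} π≈σ)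
      ; id-∈   = resp (λ i → sym (Fin.opposite-involutive i)) one
      ; ·-∈    = λ {π} {σ} p q → resp (λ i → sym (rc-· π σ i)) (mul p q)
      ; flip-∈ = inv
      }

  ≅-rc : ∀ {C _∙_} {A B : Pred (Perm n) 0ℓ} → (∀ {π} → A π → B (rc π)) → (∀ {π} → B π → A (rc π)) →
         IsoTo ⟨ A ⟩ C _∙_ → IsoTo ⟨ B ⟩ C _∙_
  ≅-rc {C} {_∙_} {A} {B} A⇒B B⇒A (φ , φ∈A , φ-injective , φ-onto , φ-hom) =
    rc ∘ φ , (λ x → ⟨⟩-rc A⇒B (φ∈A x)) , injective′ , onto′ , hom′
    where
    injective′ : ∀ x y → rc (φ x) ≈ rc (φ y) → x ≡ y
    injective′ x y eq = φ-injective x y λ i →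
      trans (sym (rc-involutive (φ x) i)) (trans (rc-cong {rc (φ x)} {rc (φ y)} eq i) (rc-involutive (φ y) i))
    onto′ : ∀ π → ⟨ B ⟩ π → ∃ λ x → rc (φ x) ≈ π
    onto′ π π∈B with φ-onto (rc π) (⟨⟩-rc B⇒A π∈B)
    ... | x , φx≈rcπ = x , λ i → trans (rc-cong {φ x} {rc π} φx≈rcπ i) (rc-involutive π i)
    hom′ : ∀ x y → rc (φ (x ∙ y)) ≈ rc (φ x) · rc (φ y)
    hom′ x y i = trans (rc-cong {φ (x ∙ y)} {φ x · φ y} (φ-hom x y) i) (rc-· (φ x) (φ y) i)

contains-rc : ∀ {n k} {π : Perm n} {τ : Perm k} → Contains π τ → Contains (rc π) (rc τ)
contains-rc {n} {k} {π} {τ} (f , f-inc , f-iso) = f′ , f′-inc , λ i j → mk⇔ (to i j) (from i j)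
  where
  f′ : Fin k → Fin n
  f′ i = opposite (f (opposite i))
  f′-inc : ∀ i j → i <ᶠ j → f′ i <ᶠ f′ j
  f′-inc i j i<j = opposite-reverses (f-inc _ _ (opposite-reverses i<j))
  to : ∀ i j → rc π ⟨$⟩ʳ f′ i <ᶠ rc π ⟨$⟩ʳ f′ j → rc τ ⟨$⟩ʳ i <ᶠ rc τ ⟨$⟩ʳ j
  to i j lt = opposite-reverses (Equivalence.to (f-iso _ _)
    (opposite-reflects (subst₂ _<ᶠ_ (rc-opposite π _) (rc-opposite π _) lt)))
  from : ∀ i j → rc τ ⟨$⟩ʳ i <ᶠ rc τ ⟨$⟩ʳ j → rc π ⟨$⟩ʳ f′ i <ᶠ rc π ⟨$⟩ʳ f′ j
  from i j lt = subst₂ _<ᶠ_ (sym (rc-opposite π _)) (sym (rc-opposite π _))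
    (opposite-reverses (Equivalence.from (f-iso _ _) (opposite-reflects lt)))

rc₃ : S₃ → S₃
rc₃ τ123 = τ123
rc₃ τ132 = τ213
rc₃ τ213 = τ132
rc₃ τ231 = τ312
rc₃ τ312 = τ231
rc₃ τ321 = τ321

rc-perm₃ : ∀ t → rc (perm₃ (rc₃ t)) ≈ perm₃ t
rc-perm₃ τ123 = λ { 0F → refl ; 1F → refl ; 2F → refl }
rc-perm₃ τ132 = λ { 0F → refl ; 1F → refl ; 2F → refl }
rc-perm₃ τ213 = λ { 0F → refl ; 1F → refl ; 2F → refl }
rc-perm₃ τ231 = λ { 0F → refl ; 1F → refl ; 2F → refl }
rc-perm₃ τ312 = λ { 0F → refl ; 1F → refl ; 2F → refl }
rc-perm₃ τ321 = λ { 0F → refl ; 1F → refl ; 2F → refl }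

Av₃-rc : ∀ {n ts us} → map rc₃ ts ↭ us → ∀ {π : Perm n} → Av₃ n ts π → Av₃ n us (rc π)
Av₃-rc {n} {ts} {us} rc[ts]↭us {π} av = All⇒Av₃ {π = rc π} (All-resp-↭ rc[ts]↭us rc-avoids)
  where
  avoids-rc : ∀ {t} → Avoids π (perm₃ t) → Avoids (rc π) (perm₃ (rc₃ t))
  avoids-rc {t} π-avoids C = π-avoids
    (contains-resp {π = rc (rc π)} {π} {rc (perm₃ (rc₃ t))} {perm₃ t} (rc-involutive π) (rc-perm₃ t)
      (contains-rc {π = rc π} {perm₃ (rc₃ t)} C))
  rc-avoids : All (λ t → Avoids (rc π) (perm₃ t)) (map rc₃ ts)
  rc-avoids = All.map⁺ (All.map (λ {t} → avoids-rc {t}) (Av₃⇒All {π = π} av))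

≅-rc₃ : ∀ {n ts us C _∙_} → map rc₃ ts ↭ us → map rc₃ us ↭ ts →
        IsoTo ⟨ Av₃ n ts ⟩ C _∙_ → IsoTo ⟨ Av₃ n us ⟩ C _∙_
≅-rc₃ rc[ts]↭us rc[us]↭ts = ≅-rc (λ {π} → Av₃-rc rc[ts]↭us {π}) (λ {π} → Av₃-rc rc[us]↭ts {π})

-- The classes

Av[132,213,231,312,321]-trivial : ∀ m → IsTrivial ⟨ Av₃ (3 + m) (τ132 ∷ τ213 ∷ τ231 ∷ τ312 ∷ τ321 ∷ []) ⟩
Av[132,213,231,312,321]-trivial m = ⟨⟩-trivial λ {π} av → increasing⇒≈id π (increasing π av)
  where
  forbidden : List S₃
  forbidden = τ132 ∷ τ213 ∷ τ231 ∷ τ312 ∷ τ321 ∷ []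
  cover : ∀ t → t ∈ forbidden ⊎ t ∈ τ123 ∷ []
  cover τ123 = inj₂ (here refl)
  cover τ132 = inj₁ (here refl)
  cover τ213 = inj₁ (there (here refl))
  cover τ231 = inj₁ (there (there (here refl)))
  cover τ312 = inj₁ (there (there (there (here refl))))
  cover τ321 = inj₁ (there (there (there (there (here refl)))))
  increasing : ∀ π → Av₃ (3 + m) forbidden π → Increasing π
  increasing π av = triples⇒pairs (λ i j → π ⟨$⟩ʳ i <ᶠ π ⟨$⟩ʳ j) increasing-triple
    where
    increasing-triple : ∀ a b c → a <ᶠ b → b <ᶠ c →
                        π ⟨$⟩ʳ a <ᶠ π ⟨$⟩ʳ b × π ⟨$⟩ʳ a <ᶠ π ⟨$⟩ʳ c × π ⟨$⟩ʳ b <ᶠ π ⟨$⟩ʳ c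
    increasing-triple a b c a<b b<c with triple-type π cover av a b c a<b b<c
    ... | here (ab , bc) = ab , Fin.<-trans ab bc , bc

opposite-0≢0 : ∀ {m} → opposite {2 + m} 0F ≢ 0F
opposite-0≢0 eq with trans (sym (Fin.opposite-prop 0F)) (cong toℕ eq)
... | ()

Av[123,132,213,231,312]≅Z₂ : ∀ m → ≅Z ⟨ Av₃ (3 + m) (τ123 ∷ τ132 ∷ τ213 ∷ τ231 ∷ τ312 ∷ []) ⟩ 2
Av[123,132,213,231,312]≅Z₂ m =
  involution-≅Z₂ opposite Fin.opposite-involutive opposite-0≢0
    (λ {π} av → inj₂ (decreasing⇒≈reverse π (decreasing π av)))
    (decreasing⇒Av₃ reverse reverse-decreasing forbidden ((λ ()) ∷ (λ ()) ∷ (λ ()) ∷ (λ ()) ∷ (λ ()) ∷ []))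
  where
  forbidden : List S₃
  forbidden = τ123 ∷ τ132 ∷ τ213 ∷ τ231 ∷ τ312 ∷ []
  cover : ∀ t → t ∈ forbidden ⊎ t ∈ τ321 ∷ []
  cover τ123 = inj₁ (here refl)
  cover τ132 = inj₁ (there (here refl))
  cover τ213 = inj₁ (there (there (here refl)))
  cover τ231 = inj₁ (there (there (there (here refl))))
  cover τ312 = inj₁ (there (there (there (there (here refl)))))
  cover τ321 = inj₂ (here refl)
  decreasing : ∀ π → Av₃ (3 + m) forbidden π → Decreasing π
  decreasing π av = triples⇒pairs (λ i j → π ⟨$⟩ʳ j <ᶠ π ⟨$⟩ʳ i) decreasing-triple
    where
    decreasing-triple : ∀ a b c → a <ᶠ b → b <ᶠ c →
                        π ⟨$⟩ʳ b <ᶠ π ⟨$⟩ʳ a × π ⟨$⟩ʳ c <ᶠ π ⟨$⟩ʳ a × π ⟨$⟩ʳ c <ᶠ π ⟨$⟩ʳ b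
    decreasing-triple a b c a<b b<c with triple-type π cover av a b c a<b b<c
    ... | here (cb , ba) = ba , Fin.<-trans cb ba , cb

module Av[132,213,231,312] (m : ℕ) where

  forbidden : List S₃
  forbidden = τ132 ∷ τ213 ∷ τ231 ∷ τ312 ∷ []

  cover : ∀ t → t ∈ forbidden ⊎ t ∈ τ123 ∷ τ321 ∷ []
  cover τ123 = inj₂ (here refl)
  cover τ132 = inj₁ (here refl)
  cover τ213 = inj₁ (there (here refl))
  cover τ231 = inj₁ (there (there (here refl)))
  cover τ312 = inj₁ (there (there (there (here refl))))
  cover τ321 = inj₂ (there (here refl))

  reverse∈Av : Av₃ (2 + m) forbidden reverse
  reverse∈Av = decreasing⇒Av₃ reverse reverse-decreasing forbidden ((λ ()) ∷ (λ ()) ∷ (λ ()) ∷ (λ ()) ∷ [])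

  module _ (π : Perm (2 + m)) (av : Av₃ (2 + m) forbidden π) where

    increasing : π ⟨$⟩ʳ 0F <ᶠ π ⟨$⟩ʳ 1F → Increasing π
    increasing 0<1 0F      (suc j) _   = first-smallest j
      where
      first-smallest : ∀ k → π ⟨$⟩ʳ 0F <ᶠ π ⟨$⟩ʳ suc k
      first-smallest 0F      = 0<1
      first-smallest (suc k) with triple-type π cover av 0F 1F (suc (suc k)) z<s (s<s z<s)
      ... | here (_ , 1<k)         = Fin.<-trans 0<1 1<k
      ... | there (here (_ , 1<0)) = ⊥-elim (Fin.<-asym 0<1 1<0)
    increasing 0<1 (suc i) j       i<j with triple-type π cover av 0F (suc i) j z<s i<j
    ... | here (_ , ij)          = ij
    ... | there (here (_ , i<0)) = ⊥-elim (Fin.<-asym i<0 (increasing 0<1 0F (suc i) z<s))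

    decreasing : π ⟨$⟩ʳ 1F <ᶠ π ⟨$⟩ʳ 0F → Decreasing π
    decreasing 1<0 0F      (suc j) _   = first-largest j
      where
      first-largest : ∀ k → π ⟨$⟩ʳ suc k <ᶠ π ⟨$⟩ʳ 0F
      first-largest 0F      = 1<0
      first-largest (suc k) with triple-type π cover av 0F 1F (suc (suc k)) z<s (s<s z<s)
      ... | here (0<1 , _)         = ⊥-elim (Fin.<-asym 0<1 1<0)
      ... | there (here (k<1 , _)) = Fin.<-trans k<1 1<0
    decreasing 1<0 (suc i) j       i<j with triple-type π cover av 0F (suc i) j z<s i<j
    ... | here (0<i , _)         = ⊥-elim (Fin.<-asym 0<i (decreasing 1<0 0F (suc i) z<s))
    ... | there (here (ji , _))  = ji

Av[132,213,231,312]≅Z₂ : ∀ m → ≅Z ⟨ Av₃ (2 + m) (τ132 ∷ τ213 ∷ τ231 ∷ τ312 ∷ []) ⟩ 2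
Av[132,213,231,312]≅Z₂ m =
  involution-≅Z₂ opposite Fin.opposite-involutive opposite-0≢0 (λ {π} → monotone {π}) reverse∈Av
  where
  open Av[132,213,231,312] m
  monotone : ∀ {π} → Av₃ (2 + m) forbidden π → π ≈ id ⊎ π ≈ reverse
  monotone {π} av = Sum.map (increasing⇒≈id π ∘ increasing π av) (decreasing⇒≈reverse π ∘ decreasing π av)
    (compare-at π {0F} {1F} z<s)

module Av[132,231,312,321] (m : ℕ) where

  forbidden : List S₃
  forbidden = τ132 ∷ τ231 ∷ τ312 ∷ τ321 ∷ []

  cover : ∀ t → t ∈ forbidden ⊎ t ∈ τ123 ∷ τ213 ∷ []
  cover τ123 = inj₂ (here refl)
  cover τ132 = inj₁ (here refl)
  cover τ213 = inj₂ (there (here refl))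
  cover τ231 = inj₁ (there (here refl))
  cover τ312 = inj₁ (there (there (here refl)))
  cover τ321 = inj₁ (there (there (there (here refl))))

  swap : Perm (2 + m)
  swap = FaithfulAction.toPerm (involution swap₀₁ swap₀₁-involutive {0F} (λ ())) 1F

  swap∈Av : Av₃ (2 + m) forbidden swap
  swap∈Av = All⇒Av₃ {π = swap} {forbidden}
    (avoids₃ swap (perm₃ τ132) no-132 ∷ avoids₃ swap (perm₃ τ231) no-231 ∷
     avoids₃ swap (perm₃ τ312) no-312 ∷ avoids₃ swap (perm₃ τ321) no-321 ∷ [])
    where
    no-132 : ∀ a b c → a <ᶠ b → b <ᶠ c → ¬ OccursAt (perm₃ τ132) swap a b c
    no-132 a b c a<b b<c (_ , c<b) = Fin.<-asym c<b (proj₂ (swap₀₁-last-largest a b c a<b b<c))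
    no-231 : ∀ a b c → a <ᶠ b → b <ᶠ c → ¬ OccursAt (perm₃ τ231) swap a b c
    no-231 a b c a<b b<c (c<a , _) = Fin.<-asym c<a (proj₁ (swap₀₁-last-largest a b c a<b b<c))
    no-312 : ∀ a b c → a <ᶠ b → b <ᶠ c → ¬ OccursAt (perm₃ τ312) swap a b c
    no-312 a b c a<b b<c (_ , c<a) = Fin.<-asym c<a (proj₁ (swap₀₁-last-largest a b c a<b b<c))
    no-321 : ∀ a b c → a <ᶠ b → b <ᶠ c → ¬ OccursAt (perm₃ τ321) swap a b c
    no-321 a b c a<b b<c (c<b , _) = Fin.<-asym c<b (proj₂ (swap₀₁-last-largest a b c a<b b<c))

  module _ (π : Perm (2 + m)) (av : Av₃ (2 + m) forbidden π) where

    last-largest : ∀ i j → i <ᶠ suc (suc j) → π ⟨$⟩ʳ i <ᶠ π ⟨$⟩ʳ suc (suc j)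
    last-largest 0F j _ with triple-type π cover av 0F 1F (suc (suc j)) z<s (s<s z<s)
    ... | here (0<1 , 1<j)         = Fin.<-trans 0<1 1<j
    ... | there (here (_ , 0<j))   = 0<j
    last-largest (suc i) j i<j with triple-type π cover av 0F (suc i) (suc (suc j)) z<s i<j
    ... | here (_ , i<j)           = i<j
    ... | there (here (i<0 , 0<j)) = Fin.<-trans i<0 0<j

    increasing : π ⟨$⟩ʳ 0F <ᶠ π ⟨$⟩ʳ 1F → Increasing π
    increasing 0<1 0F      1F            _   = 0<1
    increasing 0<1 i       (suc (suc j)) i<j = last-largest i j i<j
    increasing 0<1 (suc i) 1F            (s≤s ())

    ≈swap : π ⟨$⟩ʳ 1F <ᶠ π ⟨$⟩ʳ 0F → π ≈ swap
    ≈swap 1<0 = ≈-fromOrder π swap swap<⇒π<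
      where
      swap<⇒π< : ∀ i j → swap ⟨$⟩ʳ i <ᶠ swap ⟨$⟩ʳ j → π ⟨$⟩ʳ i <ᶠ π ⟨$⟩ʳ j
      swap<⇒π< 1F            0F            _   = 1<0
      swap<⇒π< 0F            (suc (suc j)) _   = last-largest 0F j z<s
      swap<⇒π< 1F            (suc (suc j)) _   = last-largest 1F j (s<s z<s)
      swap<⇒π< (suc (suc i)) (suc (suc j)) i<j = last-largest (suc (suc i)) j i<j
      swap<⇒π< 0F            0F            (s≤s ())
      swap<⇒π< (suc (suc i)) 0F            (s≤s ())

Av[132,231,312,321]≅Z₂ : ∀ m → ≅Z ⟨ Av₃ (2 + m) (τ132 ∷ τ231 ∷ τ312 ∷ τ321 ∷ []) ⟩ 2
Av[132,231,312,321]≅Z₂ m =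
  involution-≅Z₂ swap₀₁ swap₀₁-involutive {0F} (λ ()) (λ {π} → classify {π}) swap∈Av
  where
  open Av[132,231,312,321] m
  classify : ∀ {π} → Av₃ (2 + m) forbidden π → π ≈ id ⊎ π ≈ swap
  classify {π} av = Sum.map (increasing⇒≈id π ∘ increasing π av) (≈swap π av) (compare-at π {0F} {1F} z<s)

Av[213,231,312,321]≅Z₂ : ∀ m → ≅Z ⟨ Av₃ (2 + m) (τ213 ∷ τ231 ∷ τ312 ∷ τ321 ∷ []) ⟩ 2
Av[213,231,312,321]≅Z₂ m =
  ≅-rc₃ {ts = τ132 ∷ τ231 ∷ τ312 ∷ τ321 ∷ []} (↭-prep _ (↭-swap _ _ ↭-refl)) (↭-prep _ (↭-swap _ _ ↭-refl))
    (Av[132,231,312,321]≅Z₂ m)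

-- If π 0 < π 1, every later value lies below π 1 and the later values increase, so positions
-- 2, 3, 4 carry a 123; dually, π 1 < π 0 yields a 321.
module Av[123,321] (m : ℕ) (π : Perm (5 + m)) (av : Av₃ (5 + m) (τ123 ∷ τ321 ∷ []) π) where

  cover : ∀ t → t ∈ τ123 ∷ τ321 ∷ [] ⊎ t ∈ τ132 ∷ τ213 ∷ τ231 ∷ τ312 ∷ []
  cover τ123 = inj₁ (here refl)
  cover τ132 = inj₂ (here refl)
  cover τ213 = inj₂ (there (here refl))
  cover τ231 = inj₂ (there (there (here refl)))
  cover τ312 = inj₂ (there (there (there (here refl))))
  cover τ321 = inj₁ (there (here refl))

  2<3 : _<ᶠ_ {5 + m} {5 + m} 2F 3F
  2<3 = s<s (s<s z<s)

  3<4 : _<ᶠ_ {5 + m} {5 + m} 3F 4F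
  3<4 = s<s (s<s (s<s z<s))

  module _ (0<1 : π ⟨$⟩ʳ 0F <ᶠ π ⟨$⟩ʳ 1F) where

    below-1 : ∀ k → π ⟨$⟩ʳ suc (suc k) <ᶠ π ⟨$⟩ʳ 1F
    below-1 k with triple-type π cover av 0F 1F (suc (suc k)) z<s (s<s z<s)
    ... | here (_ , k<1)                           = k<1
    ... | there (here (1<0 , _))                   = ⊥-elim (Fin.<-asym 0<1 1<0)
    ... | there (there (here (k<0 , _)))           = Fin.<-trans k<0 0<1
    ... | there (there (there (here (1<k , k<0)))) = ⊥-elim (Fin.<-asym 0<1 (Fin.<-trans 1<k k<0))

    ascending : ∀ {k l} → suc (suc k) <ᶠ suc (suc l) → π ⟨$⟩ʳ suc (suc k) <ᶠ π ⟨$⟩ʳ suc (suc l)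
    ascending {k} {l} k<l with triple-type π cover av 1F (suc (suc k)) (suc (suc l)) (s<s z<s) k<l
    ... | here (1<l , _)                           = ⊥-elim (Fin.<-asym 1<l (below-1 l))
    ... | there (here (_ , 1<l))                   = ⊥-elim (Fin.<-asym 1<l (below-1 l))
    ... | there (there (here (_ , 1<k)))           = ⊥-elim (Fin.<-asym 1<k (below-1 k))
    ... | there (there (there (here (k<l′ , _))))  = k<l′

    contains-123 : ⊥
    contains-123 = av p123 (here refl) (contains₃ π (perm₃ τ123) 2<3 3<4 (ascending 2<3 , ascending 3<4))

  module _ (1<0 : π ⟨$⟩ʳ 1F <ᶠ π ⟨$⟩ʳ 0F) where

    above-1 : ∀ k → π ⟨$⟩ʳ 1F <ᶠ π ⟨$⟩ʳ suc (suc k)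
    above-1 k with triple-type π cover av 0F 1F (suc (suc k)) z<s (s<s z<s)
    ... | here (0<k , k<1)                         = ⊥-elim (Fin.<-asym 1<0 (Fin.<-trans 0<k k<1))
    ... | there (here (_ , 0<k))                   = Fin.<-trans 1<0 0<k
    ... | there (there (here (_ , 0<1)))           = ⊥-elim (Fin.<-asym 0<1 1<0)
    ... | there (there (there (here (1<k , _))))   = 1<k

    descending : ∀ {k l} → suc (suc k) <ᶠ suc (suc l) → π ⟨$⟩ʳ suc (suc l) <ᶠ π ⟨$⟩ʳ suc (suc k)
    descending {k} {l} k<l with triple-type π cover av 1F (suc (suc k)) (suc (suc l)) (s<s z<s) k<l
    ... | here (_ , l<k)                           = l<k
    ... | there (here (k<1 , _))                   = ⊥-elim (Fin.<-asym k<1 (above-1 k))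
    ... | there (there (here (l<1 , _)))           = ⊥-elim (Fin.<-asym l<1 (above-1 l))
    ... | there (there (there (here (_ , l<1))))   = ⊥-elim (Fin.<-asym l<1 (above-1 l))

    contains-321 : ⊥
    contains-321 = av p321 (there (here refl)) (contains₃ π (perm₃ τ321) 2<3 3<4 (descending 3<4 , descending 2<3))

Av[123,321]-empty : ∀ m (π : Perm (5 + m)) → ¬ Av₃ (5 + m) (τ123 ∷ τ321 ∷ []) π
Av[123,321]-empty m π av = [ contains-123 , contains-321 ]′ (compare-at π {0F} {1F} z<s)
  where open Av[123,321] m π av

Av[123,321]∪T-trivial : ∀ (T′ : Pred Pattern 0ℓ) n → 4 < n → IsTrivial ⟨ Av n (⟦ p123 ∷ p321 ∷ [] ⟧ ∪ T′) ⟩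
Av[123,321]∪T-trivial T′ _ (s≤s (s≤s (s≤s (s≤s (s≤s {n = m} z≤n))))) =
  ⟨⟩-trivial λ {π} av → ⊥-elim (Av[123,321]-empty m π λ p p∈ → av p (inj₁ p∈))

module Av[132,213,312,321] (m : ℕ) where

  open ℤ-mod (suc m) public using (1ₘ; last)
  open ℤ-mod (suc m) using (last-view; toℕ-1ₘ⊕; 1ₘ⊕last)
  open FaithfulAction (translation (suc m)) using (toPerm)

  forbidden : List S₃
  forbidden = τ132 ∷ τ213 ∷ τ312 ∷ τ321 ∷ []

  cover : ∀ t → t ∈ forbidden ⊎ t ∈ τ123 ∷ τ231 ∷ []
  cover τ123 = inj₂ (here refl)
  cover τ132 = inj₁ (here refl)
  cover τ213 = inj₁ (there (here refl))
  cover τ231 = inj₂ (there (here refl))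
  cover τ312 = inj₁ (there (there (here refl)))
  cover τ321 = inj₁ (there (there (there (here refl))))

  rotation : Perm (2 + m)
  rotation = toPerm 1ₘ

  rotation-last≡0 : rotation ⟨$⟩ʳ last ≡ 0F
  rotation-last≡0 = 1ₘ⊕last

  rotation-increasing : ∀ i j → i <ᶠ j → j <ᶠ last → rotation ⟨$⟩ʳ i <ᶠ rotation ⟨$⟩ʳ j
  rotation-increasing i j i<j j<last =
    subst₂ _<_ (sym (toℕ-1ₘ⊕ i (Fin.<-trans i<j j<last))) (sym (toℕ-1ₘ⊕ j j<last)) (s<s i<j)

  rotation∈Av : Av₃ (2 + m) forbidden rotation
  rotation∈Av = All⇒Av₃ {π = rotation} {forbidden}
    (avoids₃ rotation (perm₃ τ132) no-132 ∷ avoids₃ rotation (perm₃ τ213) no-213 ∷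
     avoids₃ rotation (perm₃ τ312) no-312 ∷ avoids₃ rotation (perm₃ τ321) no-321 ∷ [])
    where
    first-below-second : ∀ a b c → a <ᶠ b → b <ᶠ c → rotation ⟨$⟩ʳ a <ᶠ rotation ⟨$⟩ʳ b
    first-below-second a b c a<b b<c with last-view b
    ... | inj₁ b<last = rotation-increasing a b a<b b<last
    ... | inj₂ refl   = ⊥-elim (ℕ.<-irrefl (Fin.toℕ-fromℕ (suc m)) (ℕ.<-≤-trans b<c (s≤s⁻¹ (Fin.toℕ<n c))))
    no-132 : ∀ a b c → a <ᶠ b → b <ᶠ c → ¬ OccursAt (perm₃ τ132) rotation a b c
    no-132 a b c a<b b<c (ac , cb) with last-view c
    ... | inj₁ c<last = Fin.<-asym cb (rotation-increasing b c b<c c<last)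
    ... | inj₂ refl   = ℕ.n≮0 (subst (λ k → rotation ⟨$⟩ʳ a <ᶠ k) rotation-last≡0 ac)
    no-213 : ∀ a b c → a <ᶠ b → b <ᶠ c → ¬ OccursAt (perm₃ τ213) rotation a b c
    no-213 a b c a<b b<c (ba , _) = Fin.<-asym ba (first-below-second a b c a<b b<c)
    no-312 : ∀ a b c → a <ᶠ b → b <ᶠ c → ¬ OccursAt (perm₃ τ312) rotation a b c
    no-312 a b c a<b b<c (bc , ca) = Fin.<-asym (Fin.<-trans bc ca) (first-below-second a b c a<b b<c)
    no-321 : ∀ a b c → a <ᶠ b → b <ᶠ c → ¬ OccursAt (perm₃ τ321) rotation a b c
    no-321 a b c a<b b<c (_ , ba) = Fin.<-asym ba (first-below-second a b c a<b b<c)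

  module _ (π : Perm (2 + m)) (av : Av₃ (2 + m) forbidden π) where

    increasing-before-last : ∀ i j → i <ᶠ j → j <ᶠ last → π ⟨$⟩ʳ i <ᶠ π ⟨$⟩ʳ j
    increasing-before-last i j i<j j<last with triple-type π cover av i j last i<j j<last
    ... | here (i<j′ , _)         = i<j′
    ... | there (here (_ , i<j′)) = i<j′

    increasing : π ⟨$⟩ʳ 0F <ᶠ π ⟨$⟩ʳ last → Increasing π
    increasing 0<last i j i<j with last-view j
    ... | inj₁ j<last = increasing-before-last i j i<j j<last
    increasing 0<last 0F      j i<j | inj₂ refl = 0<last
    increasing 0<last (suc i) j i<j | inj₂ refl with triple-type π cover av 0F (suc i) last z<s i<j
    ... | here (_ , i<last)         = i<last
    ... | there (here (last<0 , _)) = ⊥-elim (Fin.<-asym 0<last last<0)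

    ≈rotation : π ⟨$⟩ʳ last <ᶠ π ⟨$⟩ʳ 0F → π ≈ rotation
    ≈rotation last<0 = ≈-fromOrder π rotation rotation<⇒π<
      where
      last-smallest : ∀ j → j <ᶠ last → π ⟨$⟩ʳ last <ᶠ π ⟨$⟩ʳ j
      last-smallest 0F      _      = last<0
      last-smallest (suc j) j<last with triple-type π cover av 0F (suc j) last z<s j<last
      ... | here (0<j , j<last′)         = ⊥-elim (Fin.<-asym last<0 (Fin.<-trans 0<j j<last′))
      ... | there (here (last<0′ , 0<j)) = Fin.<-trans last<0′ 0<j
      rotation<⇒π< : ∀ i j → rotation ⟨$⟩ʳ i <ᶠ rotation ⟨$⟩ʳ j → π ⟨$⟩ʳ i <ᶠ π ⟨$⟩ʳ j
      rotation<⇒π< i j ri<rj with last-view i | last-view j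
      ... | inj₁ i<last | inj₁ j<last = increasing-before-last i j
            (ℕ.≤-pred (subst₂ _<_ (toℕ-1ₘ⊕ i i<last) (toℕ-1ₘ⊕ j j<last) ri<rj)) j<last
      ... | inj₁ _      | inj₂ refl   = ⊥-elim (ℕ.n≮0 (subst (λ k → rotation ⟨$⟩ʳ i <ᶠ k) rotation-last≡0 ri<rj))
      ... | inj₂ refl   | inj₁ j<last = last-smallest j j<last
      ... | inj₂ refl   | inj₂ refl   = ⊥-elim (Fin.<-irrefl refl ri<rj)

Av[132,213,312,321]≅Zₙ : ∀ m → ≅Z ⟨ Av₃ (2 + m) (τ132 ∷ τ213 ∷ τ312 ∷ τ321 ∷ []) ⟩ (2 + m)
Av[132,213,312,321]≅Zₙ m =
  ≅-generated A (λ {π} → classify {π}) (⟨⟩-cyclic (translation (suc m)) A (gen rotation∈Av))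
  where
  open Av[132,213,312,321] m
  open ℤ-mod (suc m) using (⊕-identityˡ; ⟨⟩-cyclic)
  open FaithfulAction (translation (suc m))
  A : Pred (Perm (2 + m)) 0ℓ
  A = Av₃ (2 + m) forbidden
  classify : ∀ {π} → A π → ∃ λ x → toPerm x ≈ π
  classify {π} av with compare-at π {0F} {last} z<s
  ... | inj₁ 0<last = 0F , λ i → trans (⊕-identityˡ i) (sym (increasing⇒≈id π (increasing π av 0<last) i))
  ... | inj₂ last<0 = 1ₘ , λ i → sym (≈rotation π av last<0 i)

Av[132,213,231,321]≅Zₙ : ∀ m → ≅Z ⟨ Av₃ (2 + m) (τ132 ∷ τ213 ∷ τ231 ∷ τ321 ∷ []) ⟩ (2 + m)
Av[132,213,231,321]≅Zₙ m =
  ≅-rc₃ {ts = τ132 ∷ τ213 ∷ τ312 ∷ τ321 ∷ []} (↭-swap _ _ ↭-refl) (↭-swap _ _ ↭-refl)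
    (Av[132,213,312,321]≅Zₙ m)

module Av[123,213,231,312] (m : ℕ) where

  open Dihedral m using (dihedral)
  open ℤ-mod (2 + m) using (last; ⊕-identityˡ; toℕ-⊖; ⊖0≡0; last⊕⊖≡opposite)
  open FaithfulAction dihedral using (toPerm)

  forbidden : List S₃
  forbidden = τ123 ∷ τ213 ∷ τ231 ∷ τ312 ∷ []

  cover : ∀ t → t ∈ forbidden ⊎ t ∈ τ132 ∷ τ321 ∷ []
  cover τ123 = inj₁ (here refl)
  cover τ132 = inj₂ (here refl)
  cover τ213 = inj₁ (there (here refl))
  cover τ231 = inj₁ (there (there (here refl)))
  cover τ312 = inj₁ (there (there (there (here refl))))
  cover τ321 = inj₂ (there (here refl))

  reflection₀ reflection-last : Perm (3 + m)
  reflection₀     = toPerm (0F , true)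
  reflection-last = toPerm (last , true)

  reverse≈reflection-last : reverse ≈ reflection-last
  reverse≈reflection-last i = sym (last⊕⊖≡opposite i)

  reflection₀-0≡0 : reflection₀ ⟨$⟩ʳ 0F ≡ 0F
  reflection₀-0≡0 = trans (⊕-identityˡ (⊖ 0F)) ⊖0≡0

  toℕ-reflection₀ : ∀ i → toℕ (reflection₀ ⟨$⟩ʳ suc i) ≡ 3 + m ∸ suc (toℕ i)
  toℕ-reflection₀ i = trans (cong toℕ (⊕-identityˡ (⊖ suc i)))
    (trans (toℕ-⊖ (suc i)) (m<n⇒m%n≡m (ℕ.∸-monoʳ-< z<s (ℕ.<⇒≤ (Fin.toℕ<n (suc i))))))

  reflection₀-decreasing-after-0 : ∀ i j → suc i <ᶠ suc j → reflection₀ ⟨$⟩ʳ suc j <ᶠ reflection₀ ⟨$⟩ʳ suc i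
  reflection₀-decreasing-after-0 i j i<j = subst₂ _<_ (sym (toℕ-reflection₀ j)) (sym (toℕ-reflection₀ i))
    (ℕ.∸-monoʳ-< i<j (ℕ.<⇒≤ (Fin.toℕ<n (suc j))))

  reflection-last∈Av : Av₃ (3 + m) forbidden reflection-last
  reflection-last∈Av = Av-resp {π = reverse} {reflection-last} reverse≈reflection-last
    (decreasing⇒Av₃ reverse reverse-decreasing forbidden ((λ ()) ∷ (λ ()) ∷ (λ ()) ∷ (λ ()) ∷ []))

  reflection₀∈Av : Av₃ (3 + m) forbidden reflection₀
  reflection₀∈Av = All⇒Av₃ {π = reflection₀} {forbidden}
    (avoids₃ reflection₀ (perm₃ τ123) no-123 ∷ avoids₃ reflection₀ (perm₃ τ213) no-213 ∷
     avoids₃ reflection₀ (perm₃ τ231) no-231 ∷ avoids₃ reflection₀ (perm₃ τ312) no-312 ∷ [])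
    where
    no-123 : ∀ a b c → a <ᶠ b → b <ᶠ c → ¬ OccursAt (perm₃ τ123) reflection₀ a b c
    no-123 a (suc b) (suc c) _ b<c (_ , bc) = Fin.<-asym bc (reflection₀-decreasing-after-0 b c b<c)
    no-213 : ∀ a b c → a <ᶠ b → b <ᶠ c → ¬ OccursAt (perm₃ τ213) reflection₀ a b c
    no-213 a (suc b) (suc c) _ b<c (ba , ac) = Fin.<-asym (Fin.<-trans ba ac) (reflection₀-decreasing-after-0 b c b<c)
    no-231 : ∀ a b c → a <ᶠ b → b <ᶠ c → ¬ OccursAt (perm₃ τ231) reflection₀ a b c
    no-231 0F      b       c _   _ (c<0 , _) = ℕ.n≮0 (subst (λ k → reflection₀ ⟨$⟩ʳ c <ᶠ k) reflection₀-0≡0 c<0)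
    no-231 (suc a) (suc b) c a<b _ (_ , ab)  = Fin.<-asym ab (reflection₀-decreasing-after-0 a b a<b)
    no-312 : ∀ a b c → a <ᶠ b → b <ᶠ c → ¬ OccursAt (perm₃ τ312) reflection₀ a b c
    no-312 a (suc b) (suc c) _ b<c (bc , _) = Fin.<-asym bc (reflection₀-decreasing-after-0 b c b<c)

  module _ (π : Perm (3 + m)) (av : Av₃ (3 + m) forbidden π) where

    decreasing-after-0 : ∀ i j → suc i <ᶠ suc j → π ⟨$⟩ʳ suc j <ᶠ π ⟨$⟩ʳ suc i
    decreasing-after-0 i j i<j with triple-type π cover av 0F (suc i) (suc j) z<s i<j
    ... | here (_ , ji)         = ji
    ... | there (here (ji , _)) = ji

    ≈reflection₀ : π ⟨$⟩ʳ 0F <ᶠ π ⟨$⟩ʳ 1F → π ≈ reflection₀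
    ≈reflection₀ 0<1 = ≈-fromOrder π reflection₀ reflection₀<⇒π<
      where
      first-smallest : ∀ j → π ⟨$⟩ʳ 0F <ᶠ π ⟨$⟩ʳ suc j
      first-smallest 0F      = 0<1
      first-smallest (suc j) with triple-type π cover av 0F 1F (suc (suc j)) z<s (s<s z<s)
      ... | here (0<j , _)         = 0<j
      ... | there (here (_ , 1<0)) = ⊥-elim (Fin.<-asym 0<1 1<0)
      reflection₀<⇒π< : ∀ i j → reflection₀ ⟨$⟩ʳ i <ᶠ reflection₀ ⟨$⟩ʳ j → π ⟨$⟩ʳ i <ᶠ π ⟨$⟩ʳ j
      reflection₀<⇒π< 0F      (suc j) _     = first-smallest j
      reflection₀<⇒π< 0F      0F      lt    = ⊥-elim (Fin.<-irrefl refl lt)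
      reflection₀<⇒π< (suc i) 0F      lt    =
        ⊥-elim (ℕ.n≮0 (subst (λ k → reflection₀ ⟨$⟩ʳ suc i <ᶠ k) reflection₀-0≡0 lt))
      reflection₀<⇒π< (suc i) (suc j) lt    = decreasing-after-0 j i
        (ℕ.∸-cancelʳ-< {o = 3 + m} (subst₂ _<_ (toℕ-reflection₀ i) (toℕ-reflection₀ j) lt))

    decreasing : π ⟨$⟩ʳ 1F <ᶠ π ⟨$⟩ʳ 0F → Decreasing π
    decreasing 1<0 0F      1F            _   = 1<0
    decreasing 1<0 0F      (suc (suc j)) _ with triple-type π cover av 0F 1F (suc (suc j)) z<s (s<s z<s)
    ... | here (0<j , j<1)       = ⊥-elim (Fin.<-asym 1<0 (Fin.<-trans 0<j j<1))
    ... | there (here (j<1 , _)) = Fin.<-trans j<1 1<0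
    decreasing 1<0 (suc i) (suc j) i<j = decreasing-after-0 i j i<j

Av[123,213,231,312]≅Dₙ : ∀ m → ≅D ⟨ Av₃ (3 + m) (τ123 ∷ τ213 ∷ τ231 ∷ τ312 ∷ []) ⟩ (3 + m)
Av[123,213,231,312]≅Dₙ m =
  ≅-generated A (λ {π} → classify {π}) (⟨⟩-dihedral dihedral A {0F} rotation∈A (gen reflection₀∈Av))
  where
  open Av[123,213,231,312] m
  open Dihedral m using (dihedral; ⟨⟩-dihedral)
  open ℤ-mod (2 + m) using (1ₘ; last; ⊕-identityˡ; ⊖last≡1ₘ)
  open FaithfulAction dihedral
  A : Pred (Perm (3 + m)) 0ℓ
  A = Av₃ (3 + m) forbidden
  rotation∈A : ⟨ A ⟩ (toPerm (1ₘ , false))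
  rotation∈A = subst (λ k → ⟨ A ⟩ (toPerm (k , false))) (trans (⊕-identityˡ (⊖ last)) ⊖last≡1ₘ)
    (⟨⟩-∙ A {0F , true} {last , true} (gen reflection₀∈Av) (gen reflection-last∈Av))
  classify : ∀ {π} → A π → ∃ λ x → toPerm x ≈ π
  classify {π} av with compare-at π {0F} {1F} z<s
  ... | inj₁ 0<1 = (0F , true) , λ i → sym (≈reflection₀ π av 0<1 i)
  ... | inj₂ 1<0 = (last , true) , λ i →
    sym (trans (decreasing⇒≈reverse π (decreasing π av 1<0) i) (reverse≈reflection-last i))

Av[123,132,231,312]≅Dₙ : ∀ m → ≅D ⟨ Av₃ (3 + m) (τ123 ∷ τ132 ∷ τ231 ∷ τ312 ∷ []) ⟩ (3 + m)
Av[123,132,231,312]≅Dₙ m =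
  ≅-rc₃ {ts = τ123 ∷ τ213 ∷ τ231 ∷ τ312 ∷ []}
    (↭-prep _ (↭-prep _ (↭-swap _ _ ↭-refl))) (↭-prep _ (↭-prep _ (↭-swap _ _ ↭-refl)))
    (Av[123,213,231,312]≅Dₙ m)

module Av[123,132,213,312] (m : ℕ) where

  open Dihedral₄OnEnds m using (D₄-action; region)
  open FaithfulAction D₄-action using (toPerm)

  forbidden : List S₃
  forbidden = τ123 ∷ τ132 ∷ τ213 ∷ τ312 ∷ []

  cover : ∀ t → t ∈ forbidden ⊎ t ∈ τ231 ∷ τ321 ∷ []
  cover τ123 = inj₁ (here refl)
  cover τ132 = inj₁ (there (here refl))
  cover τ213 = inj₁ (there (there (here refl)))
  cover τ231 = inj₂ (here refl)
  cover τ312 = inj₁ (there (there (there (here refl))))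
  cover τ321 = inj₂ (there (here refl))

  reflection rotation : Perm (4 + m)
  reflection = toPerm (3F , true)
  rotation   = toPerm (1F , false)

  reverse≈reflection : reverse ≈ reflection
  reverse≈reflection i with region i
  ... | inj₁ (0F , refl) = refl
  ... | inj₁ (1F , refl) = Fin.opposite-involutive 1F
  ... | inj₁ (2F , refl) = refl
  ... | inj₁ (3F , refl) = Fin.opposite-involutive 0F
  ... | inj₂ _           = refl

  rotation≈reverse∘swap₀₁ : ∀ i → rotation ⟨$⟩ʳ i ≡ opposite (swap₀₁ i)
  rotation≈reverse∘swap₀₁ 0F            = refl
  rotation≈reverse∘swap₀₁ 1F            = refl
  rotation≈reverse∘swap₀₁ (suc (suc j)) with region (suc (suc j))
  ... | inj₁ (1F , 1↦j) = trans (sym (Fin.opposite-involutive 1F)) (cong opposite 1↦j)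
  ... | inj₁ (3F , 3↦j) = trans (sym (Fin.opposite-involutive 0F)) (cong opposite 3↦j)
  ... | inj₂ _          = refl

  reflection∈Av : Av₃ (4 + m) forbidden reflection
  reflection∈Av = Av-resp {π = reverse} {reflection} reverse≈reflection
    (decreasing⇒Av₃ reverse reverse-decreasing forbidden ((λ ()) ∷ (λ ()) ∷ (λ ()) ∷ (λ ()) ∷ []))

  rotation-last-smallest : ∀ a b c → a <ᶠ b → b <ᶠ c →
                           rotation ⟨$⟩ʳ c <ᶠ rotation ⟨$⟩ʳ a × rotation ⟨$⟩ʳ c <ᶠ rotation ⟨$⟩ʳ b
  rotation-last-smallest a b c a<b b<c with swap₀₁-last-largest a b c a<b b<c
  ... | ac , bc = reversed a c ac , reversed b c bc
    where
    reversed : ∀ i j → swap₀₁ i <ᶠ swap₀₁ j → rotation ⟨$⟩ʳ j <ᶠ rotation ⟨$⟩ʳ i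
    reversed i j lt =
      subst₂ _<ᶠ_ (sym (rotation≈reverse∘swap₀₁ j)) (sym (rotation≈reverse∘swap₀₁ i)) (opposite-reverses lt)

  rotation∈Av : Av₃ (4 + m) forbidden rotation
  rotation∈Av = All⇒Av₃ {π = rotation} {forbidden}
    (avoids₃ rotation (perm₃ τ123) no-123 ∷ avoids₃ rotation (perm₃ τ132) no-132 ∷
     avoids₃ rotation (perm₃ τ213) no-213 ∷ avoids₃ rotation (perm₃ τ312) no-312 ∷ [])
    where
    no-123 : ∀ a b c → a <ᶠ b → b <ᶠ c → ¬ OccursAt (perm₃ τ123) rotation a b c
    no-123 a b c a<b b<c (_ , bc) = Fin.<-asym bc (proj₂ (rotation-last-smallest a b c a<b b<c))
    no-132 : ∀ a b c → a <ᶠ b → b <ᶠ c → ¬ OccursAt (perm₃ τ132) rotation a b c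
    no-132 a b c a<b b<c (ac , _) = Fin.<-asym ac (proj₁ (rotation-last-smallest a b c a<b b<c))
    no-213 : ∀ a b c → a <ᶠ b → b <ᶠ c → ¬ OccursAt (perm₃ τ213) rotation a b c
    no-213 a b c a<b b<c (_ , ac) = Fin.<-asym ac (proj₁ (rotation-last-smallest a b c a<b b<c))
    no-312 : ∀ a b c → a <ᶠ b → b <ᶠ c → ¬ OccursAt (perm₃ τ312) rotation a b c
    no-312 a b c a<b b<c (bc , _) = Fin.<-asym bc (proj₂ (rotation-last-smallest a b c a<b b<c))

  module _ (π : Perm (4 + m)) (av : Av₃ (4 + m) forbidden π) where

    last-smallest : ∀ i j → i <ᶠ suc (suc j) → π ⟨$⟩ʳ suc (suc j) <ᶠ π ⟨$⟩ʳ i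
    last-smallest 0F j _ with triple-type π cover av 0F 1F (suc (suc j)) z<s (s<s z<s)
    ... | here (j<0 , _)           = j<0
    ... | there (here (j<1 , 1<0)) = Fin.<-trans j<1 1<0
    last-smallest (suc i) j i<j with triple-type π cover av 0F (suc i) (suc (suc j)) z<s i<j
    ... | here (j<0 , 0<i)         = Fin.<-trans j<0 0<i
    ... | there (here (j<i , _))   = j<i

    ≈rotation : π ⟨$⟩ʳ 0F <ᶠ π ⟨$⟩ʳ 1F → π ≈ rotation
    ≈rotation 0<1 = ≈-fromOrder π rotation λ i j lt →
      swapped i j (opposite-reflects (subst₂ _<ᶠ_ (rotation≈reverse∘swap₀₁ i) (rotation≈reverse∘swap₀₁ j) lt))
      where
      swapped : ∀ i j → swap₀₁ j <ᶠ swap₀₁ i → π ⟨$⟩ʳ i <ᶠ π ⟨$⟩ʳ j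
      swapped 0F            1F            _   = 0<1
      swapped (suc (suc i)) 0F            _   = last-smallest 0F i z<s
      swapped (suc (suc i)) 1F            _   = last-smallest 1F i (s<s z<s)
      swapped (suc (suc i)) (suc (suc j)) j<i = last-smallest (suc (suc j)) i j<i
      swapped 0F            0F            (s≤s ())
      swapped 1F            1F            ()
      swapped 1F            0F            ()
      swapped 0F            (suc (suc j)) (s≤s ())
      swapped 1F            (suc (suc j)) ()

    decreasing : π ⟨$⟩ʳ 1F <ᶠ π ⟨$⟩ʳ 0F → Decreasing π
    decreasing 1<0 0F      1F            _   = 1<0
    decreasing 1<0 i       (suc (suc j)) i<j = last-smallest i j i<j
    decreasing 1<0 (suc i) 1F            (s≤s ())

Av[123,132,213,312]≅D₄ : ∀ m → ≅D ⟨ Av₃ (4 + m) (τ123 ∷ τ132 ∷ τ213 ∷ τ312 ∷ []) ⟩ 4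
Av[123,132,213,312]≅D₄ m =
  ≅-generated A (λ {π} → classify {π}) (⟨⟩-dihedral D₄-action A {3F} (gen rotation∈Av) (gen reflection∈Av))
  where
  open Av[123,132,213,312] m
  open Dihedral₄OnEnds m using (D₄-action)
  open Dihedral 1 using (⟨⟩-dihedral)
  open FaithfulAction D₄-action
  A : Pred (Perm (4 + m)) 0ℓ
  A = Av₃ (4 + m) forbidden
  classify : ∀ {π} → A π → ∃ λ x → toPerm x ≈ π
  classify {π} av with compare-at π {0F} {1F} z<s
  ... | inj₁ 0<1 = (1F , false) , λ i → sym (≈rotation π av 0<1 i)
  ... | inj₂ 1<0 = (3F , true) , λ i → sym (trans (decreasing⇒≈reverse π (decreasing π av 1<0) i) (reverse≈reflection i))

Av[123,132,213,231]≅D₄ : ∀ m → ≅D ⟨ Av₃ (4 + m) (τ123 ∷ τ132 ∷ τ213 ∷ τ231 ∷ []) ⟩ 4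
Av[123,132,213,231]≅D₄ m =
  ≅-rc₃ {ts = τ123 ∷ τ132 ∷ τ213 ∷ τ312 ∷ []} (↭-prep _ (↭-swap _ _ ↭-refl)) (↭-prep _ (↭-swap _ _ ↭-refl))
    (Av[123,132,213,312]≅D₄ m)

eventually : ∀ {P : ℕ → Set} N → (∀ m → P (N + m)) → Eventually P
eventually {P} N P[N+_] = N , λ n N≤n → subst P (ℕ.m+[n∸m]≡n N≤n) (P[N+_] (n ∸ N))

theorem8p1 :
    -- (1)
    ((T′ : Pred Pattern 0ℓ) (n : ℕ) → 4 < n →
      IsTrivial ⟨ Av n (⟦ p123 ∷ p321 ∷ [] ⟧ ∪ T′) ⟩)
    -- (2)
    × Eventually (λ n →
        ≅Z ⟨ Av n ⟦ p213 ∷ p231 ∷ p312 ∷ p321 ∷ [] ⟧ ⟩ 2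
      × ≅Z ⟨ Av n ⟦ p132 ∷ p231 ∷ p312 ∷ p321 ∷ [] ⟧ ⟩ 2
      × ≅Z ⟨ Av n ⟦ p132 ∷ p213 ∷ p231 ∷ p312 ∷ [] ⟧ ⟩ 2)
    -- (3)
    × Eventually (λ n →
        ≅D ⟨ Av n ⟦ p123 ∷ p132 ∷ p213 ∷ p231 ∷ [] ⟧ ⟩ 4
      × ≅D ⟨ Av n ⟦ p123 ∷ p132 ∷ p213 ∷ p312 ∷ [] ⟧ ⟩ 4)
    -- (4)
    × Eventually (λ n →
        ≅Z ⟨ Av n ⟦ p132 ∷ p213 ∷ p312 ∷ p321 ∷ [] ⟧ ⟩ n
      × ≅Z ⟨ Av n ⟦ p132 ∷ p213 ∷ p231 ∷ p321 ∷ [] ⟧ ⟩ n)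
    -- (5)
    × Eventually (λ n →
        ≅D ⟨ Av n ⟦ p123 ∷ p213 ∷ p231 ∷ p312 ∷ [] ⟧ ⟩ n
      × ≅D ⟨ Av n ⟦ p123 ∷ p132 ∷ p231 ∷ p312 ∷ [] ⟧ ⟩ n)
    -- (6)
    × Eventually (λ n →
        ≅Z ⟨ Av n ⟦ p123 ∷ p132 ∷ p213 ∷ p231 ∷ p312 ∷ [] ⟧ ⟩ 2)
    -- (7)
    × Eventually (λ n →
        IsTrivial ⟨ Av n ⟦ p132 ∷ p213 ∷ p231 ∷ p312 ∷ p321 ∷ [] ⟧ ⟩)
theorem8p1 =
    Av[123,321]∪T-trivial
  , eventually 2 (λ m → Av[213,231,312,321]≅Z₂ m , Av[132,231,312,321]≅Z₂ m , Av[132,213,231,312]≅Z₂ m)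
  , eventually 4 (λ m → Av[123,132,213,231]≅D₄ m , Av[123,132,213,312]≅D₄ m)
  , eventually 2 (λ m → Av[132,213,312,321]≅Zₙ m , Av[132,213,231,321]≅Zₙ m)
  , eventually 3 (λ m → Av[123,213,231,312]≅Dₙ m , Av[123,132,231,312]≅Dₙ m)
  , eventually 3 Av[123,132,213,231,312]≅Z₂
  , eventually 3 Av[132,213,231,312,321]-trivial
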